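{- Let $n,m,c$ be positive integers and take $\mathcal{G}=\mathbb{Z}$. Extend the cycling operator to pairs by $C((g_0,\ldots,g_{n-1}),(w_0,\ldots,w_{n-1}))=((g_1,\ldots,g_{n-1},g_0-c),(w_1,\ldots,w_{n-1},w_0))$. Let $\mathrm{stat}$ be a function assigning a nonnegative integer to each pair $(g,w)$ with $g\in\mathrm{AV}_n$ and $w$ a rearrangement of $1,\ldots,n$, such that $\mathrm{stat}(C(g,w))=\mathrm{stat}(g,w)$ whenever both $(g,w)$ and $C(g,w)$ are such pairs. For $k\in\{0,\ldots,n-1\}$ let $P_k(t)=\sum_{f\in\mathrm{SKF}_k}t^{\mathrm{stat}(g(f),w(f))}$. Then $P_k(t)$ is independent of $k$ (and $P_k(1)=|\mathrm{SKF}_k|$).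
   Context: $[n]=\{1,\ldots,n\}$. An area vector is $g=(g_0,\ldots,g_{n-1})\in\mathbb{Z}^n$ with $g_{i+1}\leq g_i+m$ for $0\leq i<n-1$; $\mathrm{AV}_n$ is the set of area vectors. For $f:[n]\to\mathbb{Z}$, the label sequence $w(f)=(w_0,\ldots,w_{n-1})$ is the unique rearrangement of $1,\ldots,n$ such that $f(w_0)\leq\cdots\leq f(w_{n-1})$ and $w_i<w_{i+1}$ whenever $f(w_i)=f(w_{i+1})$; writing $x_i=f(w_i)$, the area vector of $f$ is $g(f)=(g_0,\ldots,g_{n-1})$ with $g_i=mi+c-x_i$. For $k\in\{0,\ldots,n-1\}$, $f$ is $k$-skeletal iff (P0) $x_0\geq 0$; (P1) $x_i<mi+c$ for all $i\in\{n-k-1,\ldots,n-1\}$; (P2) for every $i\in\{0,\ldots,n-k-1\}$ there is $j\in\{i,\ldots,i+k\}$ with $x_j\geq mj$. $\mathrm{SKF}_k$ is the set of $k$-skeletal functions $[n]\to\mathbb{Z}$. -}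

module Defs where

open import Data.Nat as ℕ using (ℕ; zero; suc; _∸_)
open import Data.Integer as ℤ using (ℤ; +_; _-_; _+_; _*_)
open import Data.Fin using (Fin; toℕ)
open import Data.Fin.Properties using (all?; any?)
open import Data.Vec using (Vec; []; _∷_; _∷ʳ_; lookup; tabulate; allFin; toList)
open import Data.List as List using (List; filter; length; concatMap; upTo)
import Data.List as L
open import Data.Bool using (Bool; if_then_else_; _∨_; _∧_)
open import Data.Product using (_×_; ∃; Σ-syntax)
open import Relation.Binary.PropositionalEquality using (_≡_)
open import Relation.Nullary using (Dec)
open import Relation.Nullary.Decidable using (⌊_⌋; _×-dec_; _→-dec_)
open import Data.List.Relation.Binary.Permutation.Propositional using (_↭_)

-- Functions [n] → ℤ are represented as Fin n → ℤ (label i+1 ↔ i : Fin n).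

before : ∀ {n} → (Fin n → ℤ) → Fin n → Fin n → Bool
before f a b = ⌊ f a ℤ.<? f b ⌋ ∨ (⌊ f a ℤ.≟ f b ⌋ ∧ ⌊ toℕ a ℕ.<? toℕ b ⌋)

insert : ∀ {n k} → (Fin n → ℤ) → Fin n → Vec (Fin n) k → Vec (Fin n) (suc k)
insert f a [] = a ∷ []
insert f a (b ∷ bs) = if before f a b then a ∷ b ∷ bs else b ∷ insert f a bs

sortBy : ∀ {n k} → (Fin n → ℤ) → Vec (Fin n) k → Vec (Fin n) k
sortBy f [] = []
sortBy f (a ∷ as) = insert f a (sortBy f as)

labelSeq : ∀ {n} → (Fin n → ℤ) → Vec (Fin n) n
labelSeq {n} f = sortBy f (allFin n)

xs : ∀ {n} → (Fin n → ℤ) → Fin n → ℤ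
xs f i = f (lookup (labelSeq f) i)

areaVec : ∀ {n} → (m c : ℕ) → (Fin n → ℤ) → Vec ℤ n
areaVec m c f = tabulate (λ i → (+ (m ℕ.* toℕ i) + + c) - xs f i)

IsAV : ∀ {n} → (m : ℕ) → Vec ℤ n → Set
IsAV {n} m g = ∀ (i j : Fin n) → toℕ j ≡ suc (toℕ i) → lookup g j ℤ.≤ lookup g i + + m

IsRearr : ∀ {n} → Vec (Fin n) n → Set
IsRearr {n} w = toList w ↭ toList (allFin n)

cycleG : ∀ {n} → (c : ℕ) → Vec ℤ n → Vec ℤ n
cycleG c [] = []
cycleG c (g ∷ gs) = gs ∷ʳ (g - + c)

cycleW : ∀ {A : Set} {n} → Vec A n → Vec A n
cycleW [] = []
cycleW (a ∷ as) = as ∷ʳ a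

P0 : ∀ {n} → (Fin n → ℤ) → Set
P0 {n} f = ∀ (i : Fin n) → toℕ i ≡ 0 → + 0 ℤ.≤ xs f i

P1 : ∀ {n} → (m c k : ℕ) → (Fin n → ℤ) → Set
P1 {n} m c k f = ∀ (i : Fin n) → n ∸ k ∸ 1 ℕ.≤ toℕ i → xs f i ℤ.< + (m ℕ.* toℕ i) + + c

P2 : ∀ {n} → (m k : ℕ) → (Fin n → ℤ) → Set
P2 {n} m k f = ∀ (i : Fin n) → toℕ i ℕ.≤ n ∸ k ∸ 1 →
  ∃ λ (j : Fin n) → toℕ i ℕ.≤ toℕ j × toℕ j ℕ.≤ toℕ i ℕ.+ k × + (m ℕ.* toℕ j) ℤ.≤ xs f j

IsSkeletal : ∀ {n} → (m c k : ℕ) → (Fin n → ℤ) → Set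
IsSkeletal m c k f = P0 f × P1 m c k f × P2 m k f

skeletal? : ∀ {n} → (m c k : ℕ) → (f : Fin n → ℤ) → Dec (IsSkeletal m c k f)
skeletal? {n} m c k f =
  all? (λ i → (toℕ i ℕ.≟ 0) →-dec (+ 0 ℤ.≤? xs f i))
  ×-dec all? (λ i → (n ∸ k ∸ 1 ℕ.≤? toℕ i) →-dec (xs f i ℤ.<? + (m ℕ.* toℕ i) + + c))
  ×-dec all? (λ i → (toℕ i ℕ.≤? n ∸ k ∸ 1) →-dec
           any? (λ j → (toℕ i ℕ.≤? toℕ j) ×-dec (toℕ j ℕ.≤? toℕ i ℕ.+ k)
                        ×-dec (+ (m ℕ.* toℕ j) ℤ.≤? xs f j)))

vecsOver : (n : ℕ) → List ℤ → List (Vec ℤ n)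
vecsOver zero vals = [] L.∷ L.[]
vecsOver (suc n) vals = concatMap (λ v → L.map (v ∷_) (vecsOver n vals)) vals

-- the box {0,…,m n + c - 1}^n, which contains every k-skeletal function
-- (x_0 ≥ 0 by (P0), x_{n-1} < m(n-1)+c by (P1) with i = n-1)
box : (n m c : ℕ) → List (Vec ℤ n)
box n m c = vecsOver n (L.map +_ (upTo (m ℕ.* n ℕ.+ c)))

-- coefficient of t^d in P_k(t) = Σ_{f ∈ SKF_k} t^{stat(g(f),w(f))}
coeffP : (n m c : ℕ) → (stat : Vec ℤ n → Vec (Fin n) n → ℕ) → (k d : ℕ) → ℕ
coeffP n m c stat k d =
  length (filter (λ v → skeletal? m c k (lookup v)
                    ×-dec (stat (areaVec m c (lookup v)) (labelSeq (lookup v)) ℕ.≟ d))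
                 (box n m c))

-- Cycling a function f (every value drops by m, except the value of the first label
-- w₀, which rises by m(n-1)+c) cycles its area vector and rotates its label sequence,
-- so stat is constant on cycling orbits.  The area vectors along an orbit are the
-- length-n windows of a single sequence s with s(t+n) = s(t) - c, and f is k-skeletal
-- exactly when its window satisfies (P0)-(P2) read on s.  Every orbit contains exactly
-- one such window: the least t at which s is at most c and every (k+1)-block of the
-- window has an entry at most c is one, and the decrease of s rules out a second.
-- As cycling only runs forward, a k-skeletal f is first rewound by whole turns to an
-- orbit point with positive area vector; cycling on to the k′-skeletal point is then
-- a stat-preserving injection SKF_k → SKF_k′, and by symmetry the coefficients agree.
module Submission where

open import Defs
open import Data.Nat using (ℕ; _<_; NonZero)
open import Data.Integer using (ℤ)
open import Data.Fin using (Fin)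
open import Data.Vec using (Vec)
open import Relation.Binary.PropositionalEquality using (_≡_)

open import Data.Bool using (true; false; _∨_; _∧_)
open import Data.Empty using (⊥-elim)
open import Data.Fin using (zero; suc; toℕ; inject₁; fromℕ; fromℕ<)
import Data.Fin as Fin
import Data.Fin.Properties as Finₚ
open import Data.Integer using (+_; -[1+_]; ∣_∣)
import Data.Integer as ℤ
import Data.Integer.Properties as ℤₚ
open import Data.Integer.Tactic.RingSolver using (solve-∀)
open import Data.List as List using (List; []; _∷_; _++_; length; filter; upTo; concatMap; cartesianProductWith)
open import Data.List.Membership.Propositional using () renaming (_∈_ to _∈ₗ_)
open import Data.List.Membership.Propositional.Properties
  using (∈-map⁺; ∈-upTo⁺; ∈-filter⁺; ∈-filter⁻; ∈-cartesianProductWith⁺)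
  renaming (∈-lookup to ∈ₗ-lookup)
open import Data.List.Membership.Setoid.Properties using (index-injective)
open import Data.List.Relation.Binary.Permutation.Propositional using (_↭_; ↭-refl; ↭-trans; ↭-sym; prep; swap)
open import Data.List.Relation.Binary.Permutation.Propositional.Properties using (∈-resp-↭)
import Data.List.Relation.Unary.All as ListAll
import Data.List.Relation.Unary.Any as ListAny
open import Data.List.Relation.Unary.AllPairs using ([]; _∷_)
open import Data.List.Relation.Unary.Unique.Propositional using (Unique)
import Data.List.Relation.Unary.Unique.Propositional.Properties as Uniqueₚ
open import Data.Nat using (zero; suc; _+_; _*_; _∸_; _≤_; _⊔_; _≤?_; z≤n; s≤s; >-nonZero⁻¹)
import Data.Nat as ℕ
import Data.Nat.Properties as ℕₚ
open import Data.Nat.Properties using (allUpTo?; anyUpTo?)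
open import Data.Nat.DivMod using (_%_; _/_; m≡m%n+[m/n]*n; m%n<n)
open import Data.Nat.GeneralisedArithmetic using (fold; fold-+)
open import Data.Nat.Tactic.RingSolver using () renaming (solve-∀ to ℕ-solve-∀)
open import Data.Product using (_×_; _,_; proj₁; proj₂; ∃; ∃-syntax)
open import Data.Product.Relation.Binary.Lex.Strict using (×-Lex; ×-decidable; ×-isStrictTotalOrder)
open import Data.Product.Relation.Binary.Pointwise.NonDependent using (Pointwise)
open import Data.Sum using (_⊎_; inj₁; inj₂; [_,_])
open import Data.Vec using ([]; _∷_; _∷ʳ_; head; tail; last; lookup; tabulate; map; toList; allFin)
open import Data.Vec.Properties
  using ( tabulate∘lookup; tabulate-cong; lookup∘tabulate; lookup-map; map-∘; map-id; map-cong
        ; ∷-injective; ∷ʳ-injective; last-∷ʳ)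
open import Data.Vec.Membership.Propositional using (_∈_)
open import Data.Vec.Membership.Propositional.Properties using (∈-lookup; ∈-allFin⁺; ∈-toList⁺; ∈-toList⁻)
open import Data.Vec.Relation.Unary.All as All using (All; []; _∷_)
open import Data.Vec.Relation.Unary.AllPairs using (AllPairs; []; _∷_)
import Data.Vec.Relation.Unary.Any as Any
open import Data.Vec.Relation.Unary.Any using (here; there)
open import Data.Vec.Relation.Unary.Any.Properties using (lookup-index)
open import Data.Vec.Relation.Unary.Unique.Propositional using () renaming (Unique to Uniqueᵥ)
import Data.Vec.Relation.Unary.Unique.Propositional.Properties as Uniqueᵥₚ
open import Function using (_∘_; id)
open import Function.Definitions using (Injective)
open import Relation.Binary.Definitions using (Asymmetric; tri<; tri≈; tri>)
open import Relation.Binary.Structures using (IsStrictTotalOrder)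
open import Relation.Binary.PropositionalEquality
  using (refl; sym; trans; cong; cong₂; subst; subst₂; setoid; _≢_; _≗_; module ≡-Reasoning)
open import Relation.Nullary using (¬_; Dec; yes; no; does; proof)
open import Relation.Nullary.Decidable using (isYes≗does; _×-dec_)
open import Relation.Nullary.Reflects using (Reflects; ofʸ; ofⁿ)
open import Relation.Unary using (Decidable)

module _ {A : Set} where

  lookup-ext : ∀ {n} {u v : Vec A n} → (∀ i → lookup u i ≡ lookup v i) → u ≡ v
  lookup-ext {u = u} {v} u≗v = trans (sym (tabulate∘lookup u)) (trans (tabulate-cong u≗v) (tabulate∘lookup v))

  lookup-∷ʳ-inject₁ : ∀ {n} (xs : Vec A n) y i → lookup (xs ∷ʳ y) (inject₁ i) ≡ lookup xs i
  lookup-∷ʳ-inject₁ (x ∷ xs) y zero = refl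
  lookup-∷ʳ-inject₁ (x ∷ xs) y (suc i) = lookup-∷ʳ-inject₁ xs y i

  lookup-∷ʳ-fromℕ : ∀ {n} (xs : Vec A n) y → lookup (xs ∷ʳ y) (fromℕ n) ≡ y
  lookup-∷ʳ-fromℕ [] y = refl
  lookup-∷ʳ-fromℕ (x ∷ xs) y = lookup-∷ʳ-fromℕ xs y

  tabulate-∷ʳ : ∀ {n} (h : Fin (suc n) → A) → tabulate h ≡ tabulate (h ∘ inject₁) ∷ʳ h (fromℕ n)
  tabulate-∷ʳ {zero} h = refl
  tabulate-∷ʳ {suc n} h = cong (h zero ∷_) (tabulate-∷ʳ (h ∘ suc))

  head∷tail : ∀ {n} (v : Vec A (suc n)) → v ≡ head v ∷ tail v
  head∷tail (x ∷ xs) = refl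

  ∈-∷ʳ⁺ˡ : ∀ {n x y} {xs : Vec A n} → x ∈ xs → x ∈ xs ∷ʳ y
  ∈-∷ʳ⁺ˡ (here x≡) = here x≡
  ∈-∷ʳ⁺ˡ (there x∈) = there (∈-∷ʳ⁺ˡ x∈)

  ∈-∷ʳ⁺ʳ : ∀ {n} (xs : Vec A n) y → y ∈ xs ∷ʳ y
  ∈-∷ʳ⁺ʳ [] y = here refl
  ∈-∷ʳ⁺ʳ (x ∷ xs) y = there (∈-∷ʳ⁺ʳ xs y)

  last-∈ : ∀ {n} (v : Vec A (suc n)) → last v ∈ v
  last-∈ (x ∷ []) = here refl
  last-∈ (x ∷ y ∷ ys) = there (last-∈ (y ∷ ys))

  All-∷ʳ⁺ : ∀ {P : A → Set} {n x} {xs : Vec A n} → All P xs → P x → All P (xs ∷ʳ x)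
  All-∷ʳ⁺ [] px = px ∷ []
  All-∷ʳ⁺ (py ∷ pys) px = py ∷ All-∷ʳ⁺ pys px

  fold-injective : ∀ {h : A → A} → Injective _≡_ _≡_ h → ∀ t → Injective _≡_ _≡_ (λ x → fold x h t)
  fold-injective h-inj zero x≡y = x≡y
  fold-injective h-inj (suc t) hx≡hy = fold-injective h-inj t (h-inj hx≡hy)

  module _ {R : A → A → Set} where

    AllPairs-∷ʳ⁺ : ∀ {n x} {xs : Vec A n} → AllPairs R xs → All (λ y → R y x) xs → AllPairs R (xs ∷ʳ x)
    AllPairs-∷ʳ⁺ [] [] = [] ∷ []
    AllPairs-∷ʳ⁺ (y≺ys ∷ ys↑) (y≺x ∷ ys≺x) = All-∷ʳ⁺ y≺ys y≺x ∷ AllPairs-∷ʳ⁺ ys↑ ys≺x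

    AllPairs-last : ∀ {n} {v : Vec A (suc n)} → AllPairs R v → All (λ x → x ≡ last v ⊎ R x (last v)) v
    AllPairs-last {v = x ∷ []} ([] ∷ []) = inj₁ refl ∷ []
    AllPairs-last {v = x ∷ y ∷ ys} (x≺ ∷ ys↑) =
      inj₂ (All.lookup x≺ (last-∈ (y ∷ ys))) ∷ AllPairs-last ys↑

    AllPairs-lookup : ∀ {n} {v : Vec A n} → AllPairs R v → ∀ {i j} → i Fin.< j → R (lookup v i) (lookup v j)
    AllPairs-lookup {v = _ ∷ v} (x≺v ∷ _) {zero} {suc j} _ = All.lookup x≺v (∈-lookup j v)
    AllPairs-lookup (_ ∷ v↑) {suc i} {suc j} (s≤s i<j) = AllPairs-lookup v↑ i<j

    module _ (asym : Asymmetric R) where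

      private
        drop-head : ∀ {k l x} {u : Vec A k} {v : Vec A l} → All (R x) u →
                    (∀ {a} → a ∈ u → a ∈ x ∷ v) → ∀ {a} → a ∈ u → a ∈ v
        drop-head x≺u u⊆xv a∈u with u⊆xv a∈u
        ... | here refl = ⊥-elim (asym (All.lookup x≺u a∈u) (All.lookup x≺u a∈u))
        ... | there a∈v = a∈v

        heads-≡ : ∀ {k l x y} {u : Vec A k} {v : Vec A l} → All (R x) u → All (R y) v →
                  x ∈ y ∷ v → y ∈ x ∷ u → x ≡ y
        heads-≡ _ _ (here x≡y) _ = x≡y
        heads-≡ _ _ (there _) (here y≡x) = sym y≡x
        heads-≡ x≺u y≺v (there x∈v) (there y∈u) =
          ⊥-elim (asym (All.lookup x≺u y∈u) (All.lookup y≺v x∈v))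

      AllPairs-≡ : ∀ {k} {u v : Vec A k} → AllPairs R u → AllPairs R v →
                   (∀ {a} → a ∈ u → a ∈ v) → (∀ {a} → a ∈ v → a ∈ u) → u ≡ v
      AllPairs-≡ {u = []} {[]} _ _ _ _ = refl
      AllPairs-≡ {u = x ∷ u} {y ∷ v} (x≺u ∷ u↑) (y≺v ∷ v↑) u⊆v v⊆u
        with refl ← heads-≡ x≺u y≺v (u⊆v (here refl)) (v⊆u (here refl)) =
        cong (x ∷_) (AllPairs-≡ u↑ v↑ (drop-head x≺u (u⊆v ∘ there)) (drop-head y≺v (v⊆u ∘ there)))

-- The whole orbit of v under rotate is read off the single sequence track v (lookup-fold).
module Rotation {A : Set} {n : ℕ} (φ : A → A) (rotate : Vec A (suc n) → Vec A (suc n))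
                (rotate-∷ : ∀ x xs → rotate (x ∷ xs) ≡ xs ∷ʳ φ x) where

  track : Vec A (suc n) → ℕ → A
  track v t = head (fold v rotate t)

  track-fold : ∀ v s t → track (fold v rotate s) t ≡ track v (t + s)
  track-fold v s t = cong head (sym (fold-+ v rotate t))

  private
    track-rotate : ∀ v t → track (rotate v) t ≡ track v (suc t)
    track-rotate v t = trans (track-fold v 1 t) (cong (track v) (ℕₚ.+-comm t 1))

    lookup-track′ : ∀ k (i : Fin (suc n)) → toℕ i ≡ k → ∀ v → lookup v i ≡ track v k
    lookup-track′ _ zero refl (x ∷ xs) = refl
    lookup-track′ (suc k) (suc i) i≡k (x ∷ xs) = begin
      lookup xs i                          ≡⟨ sym (lookup-∷ʳ-inject₁ xs (φ x) i) ⟩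
      lookup (xs ∷ʳ φ x) (inject₁ i)       ≡⟨ cong (λ v → lookup v (inject₁ i)) (sym (rotate-∷ x xs)) ⟩
      lookup (rotate (x ∷ xs)) (inject₁ i) ≡⟨ lookup-track′ k (inject₁ i) i′≡k _ ⟩
      track (rotate (x ∷ xs)) k            ≡⟨ track-rotate (x ∷ xs) k ⟩
      track (x ∷ xs) (suc k)               ∎
      where
      open ≡-Reasoning
      i′≡k : toℕ (inject₁ i) ≡ k
      i′≡k = trans (Finₚ.toℕ-inject₁ i) (ℕₚ.suc-injective i≡k)

    lookup-rotate-last : ∀ w → lookup (rotate w) (fromℕ n) ≡ φ (head w)
    lookup-rotate-last (x ∷ xs) =
      trans (cong (λ v → lookup v (fromℕ n)) (rotate-∷ x xs)) (lookup-∷ʳ-fromℕ xs (φ x))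

  lookup-track : ∀ v i → lookup v i ≡ track v (toℕ i)
  lookup-track v i = lookup-track′ (toℕ i) i refl v

  lookup-fold : ∀ v t i → lookup (fold v rotate t) i ≡ track v (toℕ i + t)
  lookup-fold v t i = trans (lookup-track (fold v rotate t) i) (track-fold v t (toℕ i))

  track-period : ∀ v t → track v (suc n + t) ≡ φ (track v t)
  track-period v t = begin
    track v (suc n + t)              ≡⟨ sym (track-fold v t (suc n)) ⟩
    track w (suc n)                  ≡⟨ sym (track-rotate w n) ⟩
    track (rotate w) n               ≡⟨ cong (track (rotate w)) (sym (Finₚ.toℕ-fromℕ n)) ⟩
    track (rotate w) (toℕ (fromℕ n)) ≡⟨ sym (lookup-track (rotate w) (fromℕ n)) ⟩
    lookup (rotate w) (fromℕ n)      ≡⟨ lookup-rotate-last w ⟩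
    φ (head w)                       ∎
    where
    open ≡-Reasoning
    w : Vec A (suc n)
    w = fold v rotate t

  full-turn : ∀ v → fold v rotate (suc n) ≡ map φ v
  full-turn v = lookup-ext λ i → begin
    lookup (fold v rotate (suc n)) i  ≡⟨ lookup-fold v (suc n) i ⟩
    track v (toℕ i + suc n)           ≡⟨ cong (track v) (ℕₚ.+-comm (toℕ i) (suc n)) ⟩
    track v (suc n + toℕ i)           ≡⟨ track-period v (toℕ i) ⟩
    φ (track v (toℕ i))               ≡⟨ cong φ (sym (lookup-track v i)) ⟩
    φ (lookup v i)                    ≡⟨ sym (lookup-map i φ v) ⟩
    lookup (map φ v) i                ∎
    where open ≡-Reasoning

  full-turns : ∀ q v → fold v rotate (q * suc n) ≡ map (λ x → fold x φ q) v
  full-turns zero v = sym (map-id v)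
  full-turns (suc q) v = begin
    fold v rotate (suc n + q * suc n)           ≡⟨ fold-+ v rotate (suc n) ⟩
    fold (fold v rotate (q * suc n)) rotate (suc n) ≡⟨ full-turn _ ⟩
    map φ (fold v rotate (q * suc n))           ≡⟨ cong (map φ) (full-turns q v) ⟩
    map φ (map (λ x → fold x φ q) v)            ≡⟨ sym (map-∘ φ (λ x → fold x φ q) v) ⟩
    map (λ x → fold x φ (suc q)) v              ∎
    where open ≡-Reasoning

  rotate-injective : Injective _≡_ _≡_ φ → Injective _≡_ _≡_ rotate
  rotate-injective φ-inj {x ∷ xs} {y ∷ ys} eq
    with xs≡ys , φx≡φy ← ∷ʳ-injective xs ys (trans (sym (rotate-∷ x xs)) (trans eq (rotate-∷ y ys)))
    = cong₂ _∷_ (φ-inj φx≡φy) xs≡ys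

module _ {P : ℕ → Set} (P? : Decidable P) where

  private
    search : ∀ n → (∀ {u} → u < n → ¬ P u) ⊎ ∃[ t ] P t × (∀ {u} → u < t → ¬ P u)
    search zero = inj₁ (λ ())
    search (suc n) with search n
    ... | inj₂ found = inj₂ found
    ... | inj₁ none with P? n
    ...   | yes pn = inj₂ (n , pn , none)
    ...   | no ¬pn = inj₁ (λ u<1+n → [ none , (λ { refl → ¬pn }) ] (ℕₚ.m<1+n⇒m<n∨m≡n u<1+n))

  least-witness : ∀ {n} → P n → ∃[ t ] P t × (∀ {u} → u < t → ¬ P u)
  least-witness {n} pn with search (suc n)
  ... | inj₂ found = found
  ... | inj₁ none = ⊥-elim (none ℕₚ.≤-refl pn)

i≤+∣i∣ : ∀ i → i ℤ.≤ + ∣ i ∣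
i≤+∣i∣ (+ _) = ℤₚ.≤-refl
i≤+∣i∣ -[1+ _ ] = ℤ.-≤+

prefix-bound : ∀ (s : ℕ → ℤ) n → ∃[ B ] (∀ {p} → p < n → s p ℤ.≤ + B)
prefix-bound s zero = 0 , λ ()
prefix-bound s (suc n) with B , s≤B ← prefix-bound s n = B ⊔ ∣ s n ∣ , λ p<1+n →
  [ (λ p<n → ℤₚ.≤-trans (s≤B p<n) (ℤ.+≤+ (ℕₚ.m≤m⊔n B _)))
  , (λ { refl → ℤₚ.≤-trans (i≤+∣i∣ (s n)) (ℤ.+≤+ (ℕₚ.m≤n⊔m B _)) })
  ] (ℕₚ.m<1+n⇒m<n∨m≡n p<1+n)

≤-by-gap : ∀ {p q p′ q′} → q ℤ.- p ≡ q′ ℤ.- p′ → p ℤ.≤ q → p′ ℤ.≤ q′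
≤-by-gap gap p≤q = ℤₚ.0≤i-j⇒j≤i (subst (+ 0 ℤ.≤_) gap (ℤₚ.i≤j⇒0≤j-i p≤q))

<-by-gap : ∀ {p q p′ q′} → q ℤ.- p ≡ q′ ℤ.- p′ → p ℤ.< q → p′ ℤ.< q′
<-by-gap {p} {q} {p′} {q′} gap p<q = ℤₚ.suc[i]≤j⇒i<j (≤-by-gap gap′ (ℤₚ.i<j⇒suc[i]≤j p<q))
  where
  one-less : ∀ y x → y ℤ.- (+ 1 ℤ.+ x) ≡ (y ℤ.- x) ℤ.- + 1
  one-less = solve-∀
  gap′ : q ℤ.- (+ 1 ℤ.+ p) ≡ q′ ℤ.- (+ 1 ℤ.+ p′)
  gap′ = trans (one-less q p) (trans (cong (λ z → z ℤ.- + 1) gap) (sym (one-less q′ p′)))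

module _ {A B : Set} where

  Unique-lookup-injective : ∀ {xs : List A} → Unique xs →
                            ∀ {i j} → List.lookup xs i ≡ List.lookup xs j → i ≡ j
  Unique-lookup-injective (_ ∷ _) {zero} {zero} _ = refl
  Unique-lookup-injective (x∉ ∷ _) {zero} {suc j} x≡ = ⊥-elim (ListAll.lookup x∉ (∈ₗ-lookup j) x≡)
  Unique-lookup-injective (x∉ ∷ _) {suc i} {zero} ≡x = ⊥-elim (ListAll.lookup x∉ (∈ₗ-lookup i) (sym ≡x))
  Unique-lookup-injective (_ ∷ xs!) {suc i} {suc j} eq = cong suc (Unique-lookup-injective xs! eq)

  length-≤ : ∀ {xs : List A} {ys : List B} → Unique xs → (φ : A → B) →
             (∀ {x} → x ∈ₗ xs → φ x ∈ₗ ys) →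
             (∀ {x y} → x ∈ₗ xs → y ∈ₗ xs → φ x ≡ φ y → x ≡ y) →
             length xs ≤ length ys
  length-≤ {xs} {ys} xs! φ φ∈ φ-inj = Finₚ.injective⇒≤ position-injective
    where
    position : Fin (length xs) → Fin (length ys)
    position i = ListAny.index (φ∈ (∈ₗ-lookup {xs = xs} i))
    position-injective : Injective _≡_ _≡_ position
    position-injective {i} {j} eq = Unique-lookup-injective xs! (φ-inj (∈ₗ-lookup i) (∈ₗ-lookup j)
      (index-injective (setoid B) (φ∈ (∈ₗ-lookup i)) (φ∈ (∈ₗ-lookup j)) eq))

concatMap-∷ : ∀ {A : Set} {n} (xs : List A) (ys : List (Vec A n)) →
              concatMap (λ x → List.map (x ∷_) ys) xs ≡ cartesianProductWith _∷_ xs ys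
concatMap-∷ [] ys = refl
concatMap-∷ (x ∷ xs) ys = cong (List.map (x ∷_) ys ++_) (concatMap-∷ xs ys)

vecsOver-unique : ∀ n {vals} → Unique vals → Unique (vecsOver n vals)
vecsOver-unique zero _ = ListAll.[] ∷ []
vecsOver-unique (suc n) {vals} vals! = subst Unique (sym (concatMap-∷ vals (vecsOver n vals)))
  (Uniqueₚ.cartesianProductWith⁺ _∷_ ∷-injective vals! (vecsOver-unique n vals!))

∈-vecsOver : ∀ {n vals} (v : Vec ℤ n) → (∀ i → lookup v i ∈ₗ vals) → v ∈ₗ vecsOver n vals
∈-vecsOver [] _ = ListAny.here refl
∈-vecsOver {suc n} {vals} (x ∷ v) ∈vals = subst (x ∷ v ∈ₗ_) (sym (concatMap-∷ vals (vecsOver n vals)))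
  (∈-cartesianProductWith⁺ _∷_ (∈vals zero) (∈-vecsOver v (∈vals ∘ suc)))

∈-naturals : ∀ {x B} → + 0 ℤ.≤ x → x ℤ.< + B → x ∈ₗ List.map +_ (upTo B)
∈-naturals {+ _} _ (ℤ.+<+ j<B) = ∈-map⁺ +_ (∈-upTo⁺ j<B)

box-unique : ∀ n m c → Unique (box n m c)
box-unique n m c = vecsOver-unique n (Uniqueₚ.map⁺ ℤₚ.+-injective (Uniqueₚ.upTo⁺ _))

-- Label sequences

infix 4 _≺_

_≺_ : ℤ × ℕ → ℤ × ℕ → Set
_≺_ = ×-Lex _≡_ ℤ._<_ _<_

≺-isStrictTotalOrder : IsStrictTotalOrder (Pointwise _≡_ _≡_) _≺_
≺-isStrictTotalOrder = ×-isStrictTotalOrder ℤₚ.<-isStrictTotalOrder ℕₚ.<-isStrictTotalOrder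

open IsStrictTotalOrder ≺-isStrictTotalOrder
  using () renaming (trans to ≺-trans; irrefl to ≺-irrefl; asym to ≺-asym; compare to ≺-compare)

≺-+ : ∀ {x y i j} e → (x , i) ≺ (y , j) → (x ℤ.+ e , i) ≺ (y ℤ.+ e , j)
≺-+ e (inj₁ x<y) = inj₁ (ℤₚ.+-monoˡ-< e x<y)
≺-+ e (inj₂ (refl , i<j)) = inj₂ (refl , i<j)

≺⇒≤ : ∀ {x y i j} → (x , i) ≺ (y , j) → x ℤ.≤ y
≺⇒≤ (inj₁ x<y) = ℤₚ.<⇒≤ x<y
≺⇒≤ (inj₂ (refl , _)) = ℤₚ.≤-refl

module _ {n : ℕ} where

  Before : (Fin n → ℤ) → Fin n → Fin n → Set
  Before f a b = (f a , toℕ a) ≺ (f b , toℕ b)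

  before-reflects : ∀ f a b → Reflects (Before f a b) (before f a b)
  before-reflects f a b = subst (Reflects (Before f a b)) (sym before≡does) (proof ≺?)
    where
    ≺? : Dec (Before f a b)
    ≺? = ×-decidable ℤ._≟_ ℤ._<?_ ℕₚ._<?_ (f a , toℕ a) (f b , toℕ b)
    before≡does : before f a b ≡ does ≺?
    before≡does = cong₂ _∨_ (isYes≗does (f a ℤ.<? f b))
                    (cong₂ _∧_ (isYes≗does (f a ℤ.≟ f b)) (isYes≗does (toℕ a ℕₚ.<? toℕ b)))

  Before-irrefl : ∀ f {a} → ¬ Before f a a
  Before-irrefl f = ≺-irrefl (refl , refl)

  Before-total : ∀ f {a b} → a ≢ b → Before f a b ⊎ Before f b a
  Before-total f {a} {b} a≢b with ≺-compare (f a , toℕ a) (f b , toℕ b)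
  ... | tri< a≺b _ _ = inj₁ a≺b
  ... | tri≈ _ (_ , a≡b) _ = ⊥-elim (a≢b (Finₚ.toℕ-injective a≡b))
  ... | tri> _ _ b≺a = inj₂ b≺a

  Before-+ : ∀ {f g : Fin n → ℤ} {a b} e → g a ≡ f a ℤ.+ e → g b ≡ f b ℤ.+ e →
             Before f a b → Before g a b
  Before-+ {a = a} {b} e ga gb a≺b =
    subst₂ (λ x y → (x , toℕ a) ≺ (y , toℕ b)) (sym ga) (sym gb) (≺-+ e a≺b)

  Sorted : (Fin n → ℤ) → ∀ {k} → Vec (Fin n) k → Set
  Sorted f = AllPairs (Before f)

  Sorted-+ : ∀ {f g : Fin n → ℤ} {k} {w : Vec (Fin n) k} e →
             All (λ a → g a ≡ f a ℤ.+ e) w → Sorted f w → Sorted g w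
  Sorted-+ e [] [] = []
  Sorted-+ e (ga ∷ gw) (a≺w ∷ w↑) =
    All.map (λ (gb , a≺b) → Before-+ e ga gb a≺b) (All.zip (gw , a≺w)) ∷ Sorted-+ e gw w↑

  module _ (f : Fin n → ℤ) where

    insert-All : ∀ {k a} {P : Fin n → Set} (bs : Vec (Fin n) k) → P a → All P bs → All P (insert f a bs)
    insert-All [] pa [] = pa ∷ []
    insert-All {a = a} (b ∷ bs) pa (pb ∷ pbs) with before f a b
    ... | true = pa ∷ pb ∷ pbs
    ... | false = pb ∷ insert-All bs pa pbs

    insert-sorted : ∀ {k a} (bs : Vec (Fin n) k) → All (a ≢_) bs → Sorted f bs → Sorted f (insert f a bs)
    insert-sorted [] [] [] = [] ∷ []
    insert-sorted {a = a} (b ∷ bs) (a≢b ∷ a∉bs) (b≺bs ∷ bs↑) with before f a b | before-reflects f a b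
    ... | true | ofʸ a≺b = (a≺b ∷ All.map (≺-trans a≺b) b≺bs) ∷ b≺bs ∷ bs↑
    ... | false | ofⁿ a⊀b = insert-All bs b≺a b≺bs ∷ insert-sorted bs a∉bs bs↑
      where
      b≺a : Before f b a
      b≺a = [ (λ a≺b → ⊥-elim (a⊀b a≺b)) , id ] (Before-total f a≢b)

    insert-↭ : ∀ {k} a (bs : Vec (Fin n) k) → toList (insert f a bs) ↭ a List.∷ toList bs
    insert-↭ a [] = ↭-refl
    insert-↭ a (b ∷ bs) with before f a b
    ... | true = ↭-refl
    ... | false = ↭-trans (prep b (insert-↭ a bs)) (swap b a ↭-refl)

    sortBy-All : ∀ {k} {P : Fin n → Set} {as : Vec (Fin n) k} → All P as → All P (sortBy f as)
    sortBy-All {as = []} [] = []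
    sortBy-All {as = a ∷ as} (pa ∷ pas) = insert-All (sortBy f as) pa (sortBy-All pas)

    sortBy-sorted : ∀ {k} {as : Vec (Fin n) k} → Uniqueᵥ as → Sorted f (sortBy f as)
    sortBy-sorted {as = []} [] = []
    sortBy-sorted {as = a ∷ as} (a∉as ∷ as!) = insert-sorted (sortBy f as) (sortBy-All a∉as) (sortBy-sorted as!)

    sortBy-↭ : ∀ {k} (as : Vec (Fin n) k) → toList (sortBy f as) ↭ toList as
    sortBy-↭ [] = ↭-refl
    sortBy-↭ (a ∷ as) = ↭-trans (insert-↭ a (sortBy f as)) (prep a (sortBy-↭ as))

  labelSeq-sorted : ∀ f → Sorted f (labelSeq f)
  labelSeq-sorted f = sortBy-sorted f (Uniqueᵥₚ.tabulate⁺ id)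

  labelSeq-rearr : ∀ f → IsRearr (labelSeq f)
  labelSeq-rearr f = sortBy-↭ f (allFin n)

  ∈-labelSeq : ∀ f a → a ∈ labelSeq f
  ∈-labelSeq f a = ∈-toList⁻ (∈-resp-↭ (↭-sym (labelSeq-rearr f)) (∈-toList⁺ (∈-allFin⁺ a)))

  labelSeq-unique : ∀ f {w : Vec (Fin n) n} → Sorted f w → (∀ a → a ∈ w) → labelSeq f ≡ w
  labelSeq-unique f w↑ ∈w =
    AllPairs-≡ ≺-asym (labelSeq-sorted f) w↑ (λ {a} _ → ∈w a) (λ {a} _ → ∈-labelSeq f a)

  labelSeq-+ : ∀ (f : Fin n → ℤ) e → labelSeq (λ a → f a ℤ.+ e) ≡ labelSeq f
  labelSeq-+ f e = labelSeq-unique _ (Sorted-+ e (All.universal (λ _ → refl) _) (labelSeq-sorted f)) (∈-labelSeq f)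

  labelSeq-≗ : ∀ {f g : Fin n → ℤ} → f ≗ g → labelSeq f ≡ labelSeq g
  labelSeq-≗ {f} {g} f≗g =
    sym (labelSeq-unique g (Sorted-+ (+ 0) (All.universal g≡f+0 _) (labelSeq-sorted f)) (∈-labelSeq f))
    where
    g≡f+0 : ∀ a → g a ≡ f a ℤ.+ + 0
    g≡f+0 a = trans (sym (f≗g a)) (sym (ℤₚ.+-identityʳ (f a)))

  xs-mono : ∀ (f : Fin n → ℤ) {i j} → toℕ i ≤ toℕ j → xs f i ℤ.≤ xs f j
  xs-mono f {i} {j} i≤j with ℕₚ.m≤n⇒m<n∨m≡n i≤j
  ... | inj₁ i<j = ≺⇒≤ (AllPairs-lookup (labelSeq-sorted f) i<j)
  ... | inj₂ i≡j = ℤₚ.≤-reflexive (cong (xs f) (Finₚ.toℕ-injective i≡j))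

  labelSeq-index : ∀ f a → ∃[ i ] lookup (labelSeq f) i ≡ a
  labelSeq-index f a = Any.index (∈-labelSeq f a) , sym (lookup-index (∈-labelSeq f a))

-- Area vectors

module _ (m c : ℕ) {n : ℕ} where

  line : Fin n → ℤ
  line i = + (m * toℕ i) ℤ.+ + c

  lookup-areaVec : ∀ f i → lookup (areaVec m c f) i ≡ line i ℤ.- xs f i
  lookup-areaVec f i = lookup∘tabulate (λ i → line i ℤ.- xs f i) i

  xs-areaVec : ∀ f i → xs f i ≡ line i ℤ.- lookup (areaVec m c f) i
  xs-areaVec f i = trans (x≡l-[l-x] (line i) (xs f i)) (cong (λ y → line i ℤ.- y) (sym (lookup-areaVec f i)))
    where
    x≡l-[l-x] : ∀ l x → x ≡ l ℤ.- (l ℤ.- x)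
    x≡l-[l-x] = solve-∀

  line-suc : ∀ {i j : Fin n} → toℕ j ≡ suc (toℕ i) → line j ≡ line i ℤ.+ + m
  line-suc {i} {j} j≡1+i = begin
    + (m * toℕ j) ℤ.+ + c         ≡⟨ cong (λ k → + (m * k) ℤ.+ + c) j≡1+i ⟩
    + (m * suc (toℕ i)) ℤ.+ + c   ≡⟨ cong (λ k → + k ℤ.+ + c) (ℕₚ.*-suc m (toℕ i)) ⟩
    + (m + m * toℕ i) ℤ.+ + c     ≡⟨ rearrange (+ m) (+ (m * toℕ i)) (+ c) ⟩
    line i ℤ.+ + m                ∎
    where
    open ≡-Reasoning
    rearrange : ∀ a b d → (a ℤ.+ b) ℤ.+ d ≡ (b ℤ.+ d) ℤ.+ a
    rearrange = solve-∀

  areaVec-IsAV : ∀ f → IsAV m (areaVec m c f)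
  areaVec-IsAV f i j j≡1+i = begin
    lookup (areaVec m c f) j          ≡⟨ lookup-areaVec f j ⟩
    line j ℤ.- xs f j                 ≤⟨ ℤₚ.+-monoʳ-≤ (line j) (ℤₚ.neg-mono-≤ (xs-mono f i≤j)) ⟩
    line j ℤ.- xs f i                 ≡⟨ cong (ℤ._- xs f i) (line-suc j≡1+i) ⟩
    (line i ℤ.+ + m) ℤ.- xs f i       ≡⟨ rearrange (line i) (+ m) (xs f i) ⟩
    (line i ℤ.- xs f i) ℤ.+ + m       ≡⟨ cong (ℤ._+ + m) (sym (lookup-areaVec f i)) ⟩
    lookup (areaVec m c f) i ℤ.+ + m  ∎
    where
    open ℤₚ.≤-Reasoning
    i≤j : toℕ i ≤ toℕ j
    i≤j = ℕₚ.≤-trans (ℕₚ.n≤1+n _) (ℕₚ.≤-reflexive (sym j≡1+i))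
    rearrange : ∀ l a x → (l ℤ.+ a) ℤ.- x ≡ (l ℤ.- x) ℤ.+ a
    rearrange = solve-∀

  areaVec-injective : ∀ {f g} → labelSeq f ≡ labelSeq g → areaVec m c f ≡ areaVec m c g → f ≗ g
  areaVec-injective {f} {g} w≡ g≡ a with i , wᵢ≡a ← labelSeq-index f a = begin
    f a                                 ≡⟨ cong f (sym wᵢ≡a) ⟩
    xs f i                              ≡⟨ xs-areaVec f i ⟩
    line i ℤ.- lookup (areaVec m c f) i ≡⟨ cong (λ v → line i ℤ.- lookup v i) g≡ ⟩
    line i ℤ.- lookup (areaVec m c g) i ≡⟨ sym (xs-areaVec g i) ⟩
    xs g i                              ≡⟨ cong (λ w → g (lookup w i)) (sym w≡) ⟩
    g (lookup (labelSeq f) i)           ≡⟨ cong g wᵢ≡a ⟩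
    g a                                 ∎
    where open ≡-Reasoning

  areaVec-≗ : ∀ {f g} → f ≗ g → areaVec m c f ≡ areaVec m c g
  areaVec-≗ {f} {g} f≗g = tabulate-cong λ i →
    cong (λ x → line i ℤ.- x) (trans (f≗g _) (cong (λ w → g (lookup w i)) (labelSeq-≗ f≗g)))

-- Cycling

module Cycling (n' m c : ℕ) .{{_ : NonZero c}} where

  K : ℤ
  K = + (m * n') ℤ.+ + c

  -- The cycling operator C, which the paper defines on pairs (g(f), w(f)), lifted to functions.
  cycleF : (Fin (suc n') → ℤ) → Fin (suc n') → ℤ
  cycleF f a with a Fin.≟ head (labelSeq f)
  ... | yes _ = f a ℤ.+ K
  ... | no _ = f a ℤ.- + m

  cycleF-head : ∀ f → cycleF f (head (labelSeq f)) ≡ f (head (labelSeq f)) ℤ.+ K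
  cycleF-head f with head (labelSeq f) Fin.≟ head (labelSeq f)
  ... | yes _ = refl
  ... | no h≢h = ⊥-elim (h≢h refl)

  cycleF-other : ∀ f {a} → a ≢ head (labelSeq f) → cycleF f a ≡ f a ℤ.- + m
  cycleF-other f {a} a≢h with a Fin.≟ head (labelSeq f)
  ... | yes a≡h = ⊥-elim (a≢h a≡h)
  ... | no _ = refl

  -- After cycling, the last label must still come before the first one.
  CyclableAt : (Fin (suc n') → ℤ) → Vec (Fin (suc n')) (suc n') → Set
  CyclableAt f w = (f (last w) ℤ.- + m , toℕ (last w)) ≺ (f (head w) ℤ.+ K , toℕ (head w))

  Cyclable : (Fin (suc n') → ℤ) → Set
  Cyclable f = CyclableAt f (labelSeq f)

  -m<K : ℤ.- + m ℤ.< K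
  -m<K = ℤₚ.≤-<-trans ℤₚ.neg-≤-pos (ℤ.+<+ (ℕₚ.<-≤-trans (>-nonZero⁻¹ c) (ℕₚ.m≤n+m c (m * n'))))

  module _ {f : Fin (suc n') → ℤ} (cyc : Cyclable f) where

    private
      a : Fin (suc n')
      a = head (labelSeq f)

      ws : Vec (Fin (suc n')) n'
      ws = tail (labelSeq f)

      w≡ : labelSeq f ≡ a ∷ ws
      w≡ = head∷tail (labelSeq f)

      a∷ws↑ : Sorted f (a ∷ ws)
      a∷ws↑ = subst (Sorted f) w≡ (labelSeq-sorted f)

      a≺ws : All (Before f a) ws
      a≺ws with a≺ws ∷ _ ← a∷ws↑ = a≺ws

      ws↑ : Sorted f ws
      ws↑ with _ ∷ ws↑ ← a∷ws↑ = ws↑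

      cycleF-a : cycleF f a ≡ f a ℤ.+ K
      cycleF-a = cycleF-head f

      cycleF-ws : All (λ b → cycleF f b ≡ f b ℤ.- + m) ws
      cycleF-ws = All.map (λ a≺b → cycleF-other f (λ b≡a → Before-irrefl f (subst (Before f a) b≡a a≺b)))
                          a≺ws

      ≺a : ∀ {b} → b ≡ last (a ∷ ws) ⊎ Before f b (last (a ∷ ws)) →
           (f b ℤ.- + m , toℕ b) ≺ (f a ℤ.+ K , toℕ a)
      ≺a (inj₁ refl) = subst (CyclableAt f) w≡ cyc
      ≺a (inj₂ b≺l) = ≺-trans (≺-+ (ℤ.- + m) b≺l) (subst (CyclableAt f) w≡ cyc)

      ws≺a : All (λ b → Before (cycleF f) b a) ws
      ws≺a = All.map (λ (cb , b≤l) → subst₂ (λ x y → (x , _) ≺ (y , _)) (sym cb) (sym cycleF-a) (≺a b≤l))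
                     (All.zip (cycleF-ws , All.tail (AllPairs-last a∷ws↑)))

      rotated-cyclable : ∀ (us : Vec (Fin (suc n')) n') → All (Before f a) us →
                         All (λ b → cycleF f b ≡ f b ℤ.- + m) us → CyclableAt (cycleF f) (us ∷ʳ a)
      rotated-cyclable [] [] [] rewrite cycleF-a = inj₁ (ℤₚ.+-monoʳ-< (f a ℤ.+ K) -m<K)
      rotated-cyclable (b ∷ us) (a≺b ∷ _) (cb ∷ _) rewrite last-∷ʳ a us | cycleF-a | cb =
        subst₂ (λ x y → (x , _) ≺ (y , _)) (sym (ℤₚ.+-assoc (f a) K (ℤ.- + m))) (reorder (f b) K (+ m))
               (≺-+ (K ℤ.- + m) a≺b)
        where
        reorder : ∀ x k y → x ℤ.+ (k ℤ.- y) ≡ x ℤ.- y ℤ.+ k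
        reorder = solve-∀

      labelSeq-cycleF : labelSeq (cycleF f) ≡ ws ∷ʳ a
      labelSeq-cycleF =
        labelSeq-unique (cycleF f) (AllPairs-∷ʳ⁺ (Sorted-+ (ℤ.- + m) cycleF-ws ws↑) ws≺a) ∈ws∷ʳa
        where
        ∈ws∷ʳa : ∀ b → b ∈ ws ∷ʳ a
        ∈ws∷ʳa b with subst (b ∈_) w≡ (∈-labelSeq f b)
        ... | here refl = ∈-∷ʳ⁺ʳ ws a
        ... | there b∈ws = ∈-∷ʳ⁺ˡ b∈ws

      area-init : ∀ j → line m c (inject₁ j) ℤ.- cycleF f (lookup (ws ∷ʳ a) (inject₁ j)) ≡
                        line m c (suc j) ℤ.- f (lookup ws j)
      area-init j = begin
        line m c (inject₁ j) ℤ.- cycleF f (lookup (ws ∷ʳ a) (inject₁ j))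
          ≡⟨ cong (λ b → line m c (inject₁ j) ℤ.- cycleF f b) (lookup-∷ʳ-inject₁ ws a j) ⟩
        line m c (inject₁ j) ℤ.- cycleF f (lookup ws j)
          ≡⟨ cong (λ y → line m c (inject₁ j) ℤ.- y) (All.lookup cycleF-ws (∈-lookup j ws)) ⟩
        line m c (inject₁ j) ℤ.- (f (lookup ws j) ℤ.- + m)
          ≡⟨ regroup (line m c (inject₁ j)) (f (lookup ws j)) (+ m) ⟩
        (line m c (inject₁ j) ℤ.+ + m) ℤ.- f (lookup ws j)
          ≡⟨ cong (ℤ._- f (lookup ws j)) (sym (line-suc m c (cong suc (sym (Finₚ.toℕ-inject₁ j))))) ⟩
        line m c (suc j) ℤ.- f (lookup ws j) ∎
        where
        open ≡-Reasoning
        regroup : ∀ l x y → l ℤ.- (x ℤ.- y) ≡ (l ℤ.+ y) ℤ.- x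
        regroup = solve-∀

      area-last : line m c (fromℕ n') ℤ.- cycleF f (lookup (ws ∷ʳ a) (fromℕ n')) ≡
                  (line m c (zero {n'}) ℤ.- f a) ℤ.- + c
      area-last = begin
        line m c (fromℕ n') ℤ.- cycleF f (lookup (ws ∷ʳ a) (fromℕ n'))
          ≡⟨ cong₂ (λ i b → (+ (m * i) ℤ.+ + c) ℤ.- cycleF f b)
                   (Finₚ.toℕ-fromℕ n') (lookup-∷ʳ-fromℕ ws a) ⟩
        K ℤ.- cycleF f a
          ≡⟨ cong (λ y → K ℤ.- y) cycleF-a ⟩
        K ℤ.- (f a ℤ.+ K)
          ≡⟨ cancel K (+ c) (f a) ⟩
        (+ 0 ℤ.+ + c ℤ.- f a) ℤ.- + c
          ≡⟨ cong (λ z → (+ z ℤ.+ + c ℤ.- f a) ℤ.- + c) (sym (ℕₚ.*-zeroʳ m)) ⟩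
        (line m c (zero {n'}) ℤ.- f a) ℤ.- + c ∎
        where
        open ≡-Reasoning
        cancel : ∀ k y x → k ℤ.- (x ℤ.+ k) ≡ (+ 0 ℤ.+ y ℤ.- x) ℤ.- y
        cancel = solve-∀

    cycleF-labelSeq : labelSeq (cycleF f) ≡ cycleW (labelSeq f)
    cycleF-labelSeq = trans labelSeq-cycleF (cong cycleW (sym w≡))

    cycleF-cyclable : Cyclable (cycleF f)
    cycleF-cyclable = subst (CyclableAt (cycleF f)) (sym labelSeq-cycleF) (rotated-cyclable ws a≺ws cycleF-ws)

    cycleF-areaVec : areaVec m c (cycleF f) ≡ cycleG c (areaVec m c f)
    cycleF-areaVec = begin
      areaVec m c (cycleF f)
        ≡⟨ tabulate-cong (λ i → cong (λ w → line m c i ℤ.- cycleF f (lookup w i)) labelSeq-cycleF) ⟩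
      tabulate (λ i → line m c i ℤ.- cycleF f (lookup (ws ∷ʳ a) i))
        ≡⟨ tabulate-∷ʳ (λ i → line m c i ℤ.- cycleF f (lookup (ws ∷ʳ a) i)) ⟩
      tabulate (λ j → line m c (inject₁ j) ℤ.- cycleF f (lookup (ws ∷ʳ a) (inject₁ j)))
        ∷ʳ (line m c (fromℕ n') ℤ.- cycleF f (lookup (ws ∷ʳ a) (fromℕ n')))
        ≡⟨ cong₂ _∷ʳ_ (tabulate-cong area-init) area-last ⟩
      cycleG c (tabulate (λ i → line m c i ℤ.- f (lookup (a ∷ ws) i)))
        ≡⟨ cong (λ w → cycleG c (tabulate (λ i → line m c i ℤ.- f (lookup w i)))) (sym w≡) ⟩
      cycleG c (areaVec m c f) ∎
      where open ≡-Reasoning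

  module _ {f : Fin (suc n') → ℤ} (cyc : Cyclable f) where

    fold-cyclable : ∀ t → Cyclable (fold f cycleF t)
    fold-cyclable zero = cyc
    fold-cyclable (suc t) = cycleF-cyclable (fold-cyclable t)

    fold-labelSeq : ∀ t → labelSeq (fold f cycleF t) ≡ fold (labelSeq f) cycleW t
    fold-labelSeq zero = refl
    fold-labelSeq (suc t) = trans (cycleF-labelSeq (fold-cyclable t)) (cong cycleW (fold-labelSeq t))

    fold-areaVec : ∀ t → areaVec m c (fold f cycleF t) ≡ fold (areaVec m c f) (cycleG c) t
    fold-areaVec zero = refl
    fold-areaVec (suc t) = trans (cycleF-areaVec (fold-cyclable t)) (cong (cycleG c) (fold-areaVec t))

  module Invariant (stat : Vec ℤ (suc n') → Vec (Fin (suc n')) (suc n') → ℕ)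
    (stat-cycle : ∀ g w → IsAV m g → IsRearr w → IsAV m (cycleG c g) → IsRearr (cycleW w) →
                  stat (cycleG c g) (cycleW w) ≡ stat g w) where

    statF : (Fin (suc n') → ℤ) → ℕ
    statF f = stat (areaVec m c f) (labelSeq f)

    statF-cycleF : ∀ {f} → Cyclable f → statF (cycleF f) ≡ statF f
    statF-cycleF {f} cyc = trans (cong₂ stat (cycleF-areaVec cyc) (cycleF-labelSeq cyc))
      (stat-cycle _ _ (areaVec-IsAV m c f) (labelSeq-rearr f)
        (subst (IsAV m) (cycleF-areaVec cyc) (areaVec-IsAV m c (cycleF f)))
        (subst IsRearr (cycleF-labelSeq cyc) (labelSeq-rearr (cycleF f))))

    statF-fold : ∀ {f} → Cyclable f → ∀ t → statF (fold f cycleF t) ≡ statF f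
    statF-fold cyc zero = refl
    statF-fold cyc (suc t) = trans (statF-cycleF (fold-cyclable cyc t)) (statF-fold cyc t)

-- Orbit sequences

module Periodic (c n' : ℕ) (s : ℕ → ℤ) (period : ∀ t → s (suc n' + t) ≡ s t ℤ.- + c) where

  decay : ∀ q t → s (q * suc n' + t) ≡ s t ℤ.- + (q * c)
  decay zero t = sym (ℤₚ.+-identityʳ (s t))
  decay (suc q) t = begin
    s ((suc n' + q * suc n') + t)   ≡⟨ cong s (ℕₚ.+-assoc (suc n') (q * suc n') t) ⟩
    s (suc n' + (q * suc n' + t))   ≡⟨ period _ ⟩
    s (q * suc n' + t) ℤ.- + c      ≡⟨ cong (λ x → x ℤ.- + c) (decay q t) ⟩
    (s t ℤ.- + (q * c)) ℤ.- + c     ≡⟨ regroup (s t) (+ (q * c)) (+ c) ⟩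
    s t ℤ.- + (c + q * c)           ∎
    where
    open ≡-Reasoning
    regroup : ∀ x a b → (x ℤ.- a) ℤ.- b ≡ x ℤ.- (b ℤ.+ a)
    regroup = solve-∀

  positive-back : ∀ q {t} → + 0 ℤ.< s (q * suc n' + t) → + 0 ℤ.< s t
  positive-back q {t} pos =
    ℤₚ.<-≤-trans pos (subst (ℤ._≤ s t) (sym (decay q t)) (ℤₚ.i-j≤i (s t) (+ (q * c))))

  low⇒next-nonpositive : ∀ {t} → s t ℤ.≤ + c → s (suc n' + t) ℤ.≤ + 0
  low⇒next-nonpositive {t} low = subst (ℤ._≤ + 0) (sym (period t)) (ℤₚ.i≤j⇒i-j≤0 low)

  high⇒next-positive : ∀ {t} → + c ℤ.< s t → + 0 ℤ.< s (suc n' + t)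
  high⇒next-positive {t} high =
    subst₂ ℤ._<_ (ℤₚ.+-inverseʳ (+ c)) (sym (period t)) (ℤₚ.+-monoˡ-< (ℤ.- + c) high)

module Window (c n' k : ℕ) (k≤n' : k ≤ n') .{{_ : NonZero c}} where

  ν : ℕ
  ν = n' ∸ k

  ν+k≡n' : ν + k ≡ n'
  ν+k≡n' = ℕₚ.m∸n+n≡m k≤n'

  -- (P0), (P1) and (P2) for the window s 0, …, s n' of an orbit sequence; ν = n - k - 1.
  Skeletal : (ℕ → ℤ) → Set
  Skeletal s = s 0 ℤ.≤ + c
             × (∀ {d} → d < suc k → + 0 ℤ.< s (ν + d))
             × (∀ {i} → i < suc ν → ∃[ d ] d < suc k × s (i + d) ℤ.≤ + c)

  Skeletal-≗ : ∀ {s s′} → s ≗ s′ → Skeletal s → Skeletal s′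
  Skeletal-≗ s≗s′ (low₀ , block , windows) =
    subst (ℤ._≤ + c) (s≗s′ 0) low₀ ,
    (λ d<1+k → subst (+ 0 ℤ.<_) (s≗s′ _) (block d<1+k)) ,
    (λ i<1+ν → let d , d<1+k , low = windows i<1+ν in d , d<1+k , subst (ℤ._≤ + c) (s≗s′ _) low)

  module _ (s : ℕ → ℤ) (period : ∀ t → s (suc n' + t) ≡ s t ℤ.- + c) where

    open Periodic c n' s period

    low-in-window : Skeletal s → ∀ {u} → u ≤ n' → ∃[ ℓ ] ℓ ≤ u × u ≤ ℓ + k × s ℓ ℤ.≤ + c
    low-in-window (low₀ , _ , windows) {u} u≤n' with u ≤? k
    ... | yes u≤k = 0 , z≤n , u≤k , low₀
    ... | no u≰k with i , refl ← ℕₚ.m≤n⇒∃[o]m+o≡n (ℕₚ.<⇒≤ (ℕₚ.≰⇒> u≰k))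
                 with d , d<1+k , low ← windows (s≤s (ℕₚ.+-cancelˡ-≤ k i ν
                                          (subst (k + i ≤_) (trans (sym ν+k≡n') (ℕₚ.+-comm ν k)) u≤n'))) =
      i + d ,
      subst (i + d ≤_) (ℕₚ.+-comm i k) (ℕₚ.+-monoʳ-≤ i (ℕₚ.≤-pred d<1+k)) ,
      subst (_≤ (i + d) + k) (ℕₚ.+-comm i k) (ℕₚ.+-monoˡ-≤ k (ℕₚ.m≤m+n i d)) ,
      low

    -- Modulo n, the positive block of the window at b lies one period after a (k+1)-window
    -- of s; that window has an entry ≤ c, which is ≤ 0 one period later.
    skeletal-unique : Skeletal s → ∀ {b} → Skeletal (λ i → s (i + b)) → b ≡ 0
    skeletal-unique _ {zero} _ = refl
    skeletal-unique sk {suc b} (_ , block , _)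
      with ℓ , ℓ≤r , r≤ℓ+k , lowℓ ← low-in-window sk (ℕₚ.≤-pred (m%n<n b (suc n')))
      with d , r+d≡ℓ+k ← ℕₚ.m≤n⇒∃[o]m+o≡n r≤ℓ+k
      = ⊥-elim (ℤₚ.<⇒≱ wrapped (low⇒next-nonpositive lowℓ))
      where
      r q : ℕ
      r = b % suc n'
      q = b / suc n'

      d<1+k : d < suc k
      d<1+k = s≤s (ℕₚ.+-cancelˡ-≤ r d k (subst (_≤ r + k) (sym r+d≡ℓ+k) (ℕₚ.+-monoˡ-≤ k ℓ≤r)))

      unwind : (ν + d) + suc b ≡ q * suc n' + ((ν + d) + suc r)
      unwind = trans (cong (λ x → (ν + d) + suc x) (m≡m%n+[m/n]*n b (suc n'))) (reorder (ν + d) r (q * suc n'))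
        where
        reorder : ∀ (x y z : ℕ) → x + (1 + (y + z)) ≡ z + (x + (1 + y))
        reorder = ℕ-solve-∀

      wrap : (ν + d) + suc r ≡ suc n' + ℓ
      wrap = begin
        (ν + d) + suc r   ≡⟨ regroup ν d r ⟩
        suc (ν + (r + d)) ≡⟨ cong (λ x → suc (ν + x)) r+d≡ℓ+k ⟩
        suc (ν + (ℓ + k)) ≡⟨ regroup′ ν ℓ k ⟩
        suc ((ν + k) + ℓ) ≡⟨ cong (λ x → suc (x + ℓ)) ν+k≡n' ⟩
        suc n' + ℓ        ∎
        where
        open ≡-Reasoning
        regroup : ∀ (x y z : ℕ) → (x + y) + (1 + z) ≡ 1 + (x + (z + y))
        regroup = ℕ-solve-∀
        regroup′ : ∀ (x y z : ℕ) → 1 + (x + (y + z)) ≡ 1 + ((x + z) + y)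
        regroup′ = ℕ-solve-∀

      wrapped : + 0 ℤ.< s (suc n' + ℓ)
      wrapped = subst (λ p → + 0 ℤ.< s p) wrap
                  (positive-back q (subst (λ p → + 0 ℤ.< s p) unwind (block d<1+k)))

    -- (P0) and (P2) for the window starting at t.
    LowStart : ℕ → Set
    LowStart t = s t ℤ.≤ + c × (∀ {i} → i < suc ν → ∃[ d ] d < suc k × s ((i + d) + t) ℤ.≤ + c)

    lowStart? : Decidable LowStart
    lowStart? t =
      (s t ℤ.≤? + c) ×-dec allUpTo? (λ i → anyUpTo? (λ d → s ((i + d) + t) ℤ.≤? + c) (suc k)) (suc ν)

    lowStart-eventually : ∃ LowStart
    lowStart-eventually with B , s≤B ← prefix-bound s (suc n') =
      B * suc n' ,
      subst (λ p → s p ℤ.≤ + c) (ℕₚ.+-identityʳ _) (late (s≤s z≤n)) ,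
      λ {i} i<1+ν → 0 , s≤s z≤n , subst (λ p → s p ℤ.≤ + c) (reorder (B * suc n') i) (late (i<N i<1+ν))
      where
      reorder : ∀ (x y : ℕ) → x + y ≡ (y + 0) + x
      reorder = ℕ-solve-∀
      i<N : ∀ {i} → i < suc ν → i < suc n'
      i<N i<1+ν = ℕₚ.<-≤-trans i<1+ν (s≤s (ℕₚ.m∸n≤m n' k))
      late : ∀ {j} → j < suc n' → s (B * suc n' + j) ℤ.≤ + c
      late {j} j<N = begin
        s (B * suc n' + j)       ≡⟨ decay B j ⟩
        s j ℤ.- + (B * c)        ≤⟨ ℤₚ.+-monoˡ-≤ (ℤ.- + (B * c)) (s≤B j<N) ⟩
        + B ℤ.- + (B * c)        ≤⟨ ℤₚ.i≤j⇒i-j≤0 (ℤ.+≤+ (ℕₚ.m≤m*n B c)) ⟩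
        + 0                      ≤⟨ ℤ.+≤+ z≤n ⟩
        + c                      ∎
        where open ℤₚ.≤-Reasoning

    lowStart-back : ∀ {e q} → e ≤ k → s q ℤ.≤ + c → LowStart (suc e + q) → LowStart q
    lowStart-back {e} {q} e≤k low-q (low-t , windows-t) = low-q , windows-q
      where
      windows-q : ∀ {i} → i < suc ν → ∃[ d ] d < suc k × s ((i + d) + q) ℤ.≤ + c
      windows-q {zero} _ = 0 , s≤s z≤n , low-q
      windows-q {suc i} 1+i<1+ν with e ≤? i
      ... | no e≰i with d , refl ← ℕₚ.m≤n⇒∃[o]m+o≡n (ℕₚ.<⇒≤ (ℕₚ.≰⇒> e≰i)) =
        d , s≤s (ℕₚ.≤-trans (ℕₚ.m≤n+m d i) e≤k) , low-t
      ... | yes e≤i with j , refl ← ℕₚ.m≤n⇒∃[o]m+o≡n e≤i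
                    with d , d<1+k , low ←
                           windows-t (s≤s (ℕₚ.≤-trans (ℕₚ.m≤n+m j e) (ℕₚ.<⇒≤ (ℕₚ.≤-pred 1+i<1+ν)))) =
        d , d<1+k , subst (λ p → s p ℤ.≤ + c) (reorder e j d q) low
        where
        reorder : ∀ (e j d q : ℕ) → (j + d) + ((1 + e) + q) ≡ ((1 + (e + j)) + d) + q
        reorder = ℕ-solve-∀

    -- A block position at or beyond n is n places after some q < t; minimality of t
    -- forbids s q ≤ c (lowStart-back), so the block entry s q - c is positive.
    least-lowStart-skeletal : (∀ {p} → p < suc n' → + 0 ℤ.< s p) → ∀ {t} → LowStart t →
                              (∀ {u} → u < t → ¬ LowStart u) → Skeletal (λ i → s (i + t))
    least-lowStart-skeletal initially-positive {t} (low-t , windows-t) minimal = low-t , block , windows-t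
      where
      block : ∀ {d} → d < suc k → + 0 ℤ.< s ((ν + d) + t)
      block {d} (s≤s d≤k) with e , d+e≡k ← ℕₚ.m≤n⇒∃[o]m+o≡n d≤k | t ≤? e
      ... | yes t≤e = initially-positive (s≤s (begin
        (ν + d) + t   ≤⟨ ℕₚ.+-monoʳ-≤ (ν + d) t≤e ⟩
        (ν + d) + e   ≡⟨ ℕₚ.+-assoc ν d e ⟩
        ν + (d + e)   ≡⟨ cong (λ x → ν + x) d+e≡k ⟩
        ν + k         ≡⟨ ν+k≡n' ⟩
        n'            ∎))
        where open ℕₚ.≤-Reasoning
      ... | no t≰e with q , refl ← ℕₚ.m≤n⇒∃[o]m+o≡n (ℕₚ.≰⇒> t≰e) with s q ℤ.≤? + c
      ...   | yes low-q = ⊥-elim (minimal (ℕₚ.m<n+m q (s≤s z≤n))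
                                  (lowStart-back (subst (e ≤_) d+e≡k (ℕₚ.m≤n+m e d)) low-q (low-t , windows-t)))
      ...   | no high-q = subst (λ p → + 0 ℤ.< s p) (sym wrap) (high⇒next-positive (ℤₚ.≰⇒> high-q))
        where
        wrap : (ν + d) + (suc e + q) ≡ suc n' + q
        wrap = begin
          (ν + d) + (suc e + q) ≡⟨ regroup ν d e q ⟩
          suc (ν + (d + e)) + q ≡⟨ cong (λ x → suc (ν + x) + q) d+e≡k ⟩
          suc (ν + k) + q       ≡⟨ cong (λ x → suc x + q) ν+k≡n' ⟩
          suc n' + q            ∎
          where
          open ≡-Reasoning
          regroup : ∀ (x y z w : ℕ) → (x + y) + ((1 + z) + w) ≡ (1 + (x + (y + z))) + w
          regroup = ℕ-solve-∀

    private
      least : ∃[ t ] LowStart t × (∀ {u} → u < t → ¬ LowStart u)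
      least = least-witness lowStart? (proj₂ lowStart-eventually)

    first : ℕ
    first = proj₁ least

    first-skeletal : (∀ {p} → p < suc n' → + 0 ℤ.< s p) → Skeletal (λ i → s (i + first))
    first-skeletal initially-positive =
      least-lowStart-skeletal initially-positive (proj₁ (proj₂ least)) (proj₂ (proj₂ least))

-- Skeletal functions on their orbit sequence

module Bridge (m c n' k : ℕ) (k≤n' : k ≤ n') .{{_ : NonZero c}} where

  open Window c n' k k≤n'
  open Cycling n' m c using (K; Cyclable)

  private
    ν≡ : suc n' ∸ k ∸ 1 ≡ ν
    ν≡ = cong (_∸ 1) (ℕₚ.+-∸-assoc 1 k≤n')

    ν≤n' : ν ≤ n'
    ν≤n' = ℕₚ.m∸n≤m n' k

  module _ {f : Fin (suc n') → ℤ} where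

    private
      low⇒ : ∀ i → + (m * toℕ i) ℤ.≤ xs f i → lookup (areaVec m c f) i ℤ.≤ + c
      low⇒ i h = subst (ℤ._≤ + c) (sym (lookup-areaVec m c f i))
                   (≤-by-gap (gap (+ (m * toℕ i)) (+ c) (xs f i)) h)
        where
        gap : ∀ a b x → x ℤ.- a ≡ b ℤ.- ((a ℤ.+ b) ℤ.- x)
        gap = solve-∀

      low⇐ : ∀ i → lookup (areaVec m c f) i ℤ.≤ + c → + (m * toℕ i) ℤ.≤ xs f i
      low⇐ i h = ≤-by-gap (gap (+ (m * toℕ i)) (+ c) (xs f i)) (subst (ℤ._≤ + c) (lookup-areaVec m c f i) h)
        where
        gap : ∀ a b x → b ℤ.- ((a ℤ.+ b) ℤ.- x) ≡ x ℤ.- a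
        gap = solve-∀

      positive⇒ : ∀ i → xs f i ℤ.< line m c i → + 0 ℤ.< lookup (areaVec m c f) i
      positive⇒ i h = subst (+ 0 ℤ.<_) (sym (lookup-areaVec m c f i)) (<-by-gap (gap (line m c i) (xs f i)) h)
        where
        gap : ∀ l x → l ℤ.- x ≡ (l ℤ.- x) ℤ.- + 0
        gap = solve-∀

      positive⇐ : ∀ i → + 0 ℤ.< lookup (areaVec m c f) i → xs f i ℤ.< line m c i
      positive⇐ i h = <-by-gap (gap (line m c i) (xs f i)) (subst (+ 0 ℤ.<_) (lookup-areaVec m c f i) h)
        where
        gap : ∀ l x → (l ℤ.- x) ℤ.- + 0 ≡ l ℤ.- x
        gap = solve-∀

      m*0≡0 : + (m * 0) ≡ + 0
      m*0≡0 = cong +_ (ℕₚ.*-zeroʳ m)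

    module _ {s : ℕ → ℤ} (s≗g : ∀ i → s (toℕ i) ≡ lookup (areaVec m c f) i) where

      private
        within : ∀ x y → x + y ≤ ν + k → x + y < suc n'
        within _ _ le = s≤s (subst (_ ≤_) ν+k≡n' le)

        at : ∀ {p} (p<N : p < suc n') → s p ≡ lookup (areaVec m c f) (fromℕ< p<N)
        at p<N = trans (cong s (sym (Finₚ.toℕ-fromℕ< p<N))) (s≗g _)

      IsSkeletal⇒Skeletal : IsSkeletal m c k f → Skeletal s
      IsSkeletal⇒Skeletal (p0 , p1 , p2) = low₀ , block , windows
        where
        low₀ : s 0 ℤ.≤ + c
        low₀ = subst (ℤ._≤ + c) (sym (s≗g zero))
                 (low⇒ zero (subst (ℤ._≤ xs f zero) (sym m*0≡0) (p0 zero refl)))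

        block : ∀ {d} → d < suc k → + 0 ℤ.< s (ν + d)
        block {d} d<1+k = subst (+ 0 ℤ.<_) (sym (at p<N)) (positive⇒ _ (p1 _ ν≤p))
          where
          p<N : ν + d < suc n'
          p<N = within ν d (ℕₚ.+-monoʳ-≤ ν (ℕₚ.≤-pred d<1+k))
          ν≤p : suc n' ∸ k ∸ 1 ≤ toℕ (fromℕ< p<N)
          ν≤p = subst₂ _≤_ (sym ν≡) (sym (Finₚ.toℕ-fromℕ< p<N)) (ℕₚ.m≤m+n ν d)

        windows-from : ∀ ι {i} → toℕ ι ≡ i → i ≤ ν → ∃[ d ] d < suc k × s (i + d) ℤ.≤ + c
        windows-from ι refl ι≤ν
          with j , ι≤j , j≤ι+k , mj≤xj ← p2 ι (subst (toℕ ι ≤_) (sym ν≡) ι≤ν)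
          with d , ι+d≡j ← ℕₚ.m≤n⇒∃[o]m+o≡n ι≤j =
          d , d<1+k , subst (ℤ._≤ + c) (sym (trans (cong s ι+d≡j) (s≗g j))) (low⇒ j mj≤xj)
          where
          d<1+k : d < suc k
          d<1+k = s≤s (ℕₚ.+-cancelˡ-≤ (toℕ ι) d k (subst (_≤ toℕ ι + k) (sym ι+d≡j) j≤ι+k))

        windows : ∀ {i} → i < suc ν → ∃[ d ] d < suc k × s (i + d) ℤ.≤ + c
        windows {i} i<1+ν = windows-from (fromℕ< i<N) (Finₚ.toℕ-fromℕ< i<N) (ℕₚ.≤-pred i<1+ν)
          where
          i<N : i < suc n'
          i<N = ℕₚ.<-≤-trans i<1+ν (s≤s ν≤n')

      Skeletal⇒IsSkeletal : Skeletal s → IsSkeletal m c k f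
      Skeletal⇒IsSkeletal (low₀ , block , windows) = p0 , p1 , p2
        where
        p0 : ∀ i → toℕ i ≡ 0 → + 0 ℤ.≤ xs f i
        p0 zero _ = subst (ℤ._≤ xs f zero) m*0≡0 (low⇐ zero (subst (ℤ._≤ + c) (s≗g zero) low₀))

        p1 : ∀ i → suc n' ∸ k ∸ 1 ≤ toℕ i → xs f i ℤ.< line m c i
        p1 i ν≤i with d , ν+d≡i ← ℕₚ.m≤n⇒∃[o]m+o≡n (subst (_≤ toℕ i) ν≡ ν≤i) =
          positive⇐ i (subst (+ 0 ℤ.<_) (trans (cong s ν+d≡i) (s≗g i)) (block d<1+k))
          where
          d<1+k : d < suc k
          d<1+k = s≤s (ℕₚ.+-cancelˡ-≤ ν d k
                    (subst₂ _≤_ (sym ν+d≡i) (sym ν+k≡n') (ℕₚ.≤-pred (Finₚ.toℕ<n i))))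

        p2 : ∀ i → toℕ i ≤ suc n' ∸ k ∸ 1 →
             ∃ λ j → toℕ i ≤ toℕ j × toℕ j ≤ toℕ i + k × + (m * toℕ j) ℤ.≤ xs f j
        p2 i i≤ν with d , d<1+k , low ← windows (s≤s (subst (toℕ i ≤_) ν≡ i≤ν)) =
          fromℕ< p<N ,
          subst (toℕ i ≤_) (sym j≡) (ℕₚ.m≤m+n _ d) ,
          subst (_≤ toℕ i + k) (sym j≡) (ℕₚ.+-monoʳ-≤ (toℕ i) (ℕₚ.≤-pred d<1+k)) ,
          low⇐ _ (subst (ℤ._≤ + c) (at p<N) low)
          where
          p<N : toℕ i + d < suc n'
          p<N = within (toℕ i) d (ℕₚ.+-mono-≤ (subst (toℕ i ≤_) ν≡ i≤ν) (ℕₚ.≤-pred d<1+k))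
          j≡ : toℕ (fromℕ< p<N) ≡ toℕ i + d
          j≡ = Finₚ.toℕ-fromℕ< p<N

  skeletal-bounds : ∀ {f} → IsSkeletal m c k f → ∀ a → + 0 ℤ.≤ f a × f a ℤ.< K
  skeletal-bounds {f} (p0 , p1 , _) a with i , wᵢ≡a ← labelSeq-index f a =
    ℤₚ.≤-trans (p0 zero refl) (subst (xs f zero ℤ.≤_) xᵢ≡fa (xs-mono f z≤n)) ,
    ℤₚ.≤-<-trans (subst (ℤ._≤ xs f (fromℕ n')) xᵢ≡fa (xs-mono f (Finₚ.≤fromℕ i))) last<K
    where
    xᵢ≡fa : xs f i ≡ f a
    xᵢ≡fa = cong f wᵢ≡a
    last<K : xs f (fromℕ n') ℤ.< K
    last<K = subst (λ j → xs f (fromℕ n') ℤ.< + (m * j) ℤ.+ + c) (Finₚ.toℕ-fromℕ n')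
               (p1 (fromℕ n') (subst₂ _≤_ (sym ν≡) (sym (Finₚ.toℕ-fromℕ n')) ν≤n'))

  skeletal-cyclable : ∀ {f} → IsSkeletal m c k f → Cyclable f
  skeletal-cyclable {f} sk = inj₁ (begin-strict
    f (last w) ℤ.- + m   ≤⟨ ℤₚ.i-j≤i (f (last w)) (+ m) ⟩
    f (last w)           <⟨ proj₂ (skeletal-bounds {f} sk (last w)) ⟩
    K                    ≤⟨ ℤₚ.+-monoˡ-≤ K (proj₁ (skeletal-bounds {f} sk (head w))) ⟩
    f (head w) ℤ.+ K     ∎)
    where
    open ℤₚ.≤-Reasoning
    w : Vec (Fin (suc n')) (suc n')
    w = labelSeq f

-- Moving along orbits

module Transport (n' m c : ℕ) .{{_ : NonZero c}}
  (stat : Vec ℤ (suc n') → Vec (Fin (suc n')) (suc n') → ℕ)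
  (stat-cycle : ∀ g w → IsAV m g → IsRearr w → IsAV m (cycleG c g) → IsRearr (cycleW w) →
                stat (cycleG c g) (cycleW w) ≡ stat g w) where

  open Cycling n' m c
  open Invariant stat stat-cycle

  private
    module Areas = Rotation {n = n'} (λ x → x ℤ.- + c) (cycleG c) (λ _ _ → refl)
    module Labels = Rotation {n = n'} id (cycleW {Fin (suc n')}) (λ _ _ → refl)

    cycleG-injective : Injective _≡_ _≡_ (cycleG {suc n'} c)
    cycleG-injective = Areas.rotate-injective λ {x} {y} eq →
      trans (undo x (+ c)) (trans (cong (ℤ._+ + c) eq) (sym (undo y (+ c))))
      where
      undo : ∀ x y → x ≡ (x ℤ.- y) ℤ.+ y
      undo = solve-∀

    cycleW-injective : Injective _≡_ _≡_ (cycleW {Fin (suc n')})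
    cycleW-injective = Labels.rotate-injective id

  turns : ℕ
  turns = m * n'

  -- Cycling only runs forward, so we start turns · n cyclings before f (unwind-areaVec,
  -- unwind-labelSeq), where the area vector is entrywise positive (rewind-positive).
  rewind : (Fin (suc n') → ℤ) → Fin (suc n') → ℤ
  rewind f a = f a ℤ.- + (turns * c)

  rewind-labelSeq : ∀ f → labelSeq (rewind f) ≡ labelSeq f
  rewind-labelSeq f = labelSeq-+ f (ℤ.- + (turns * c))

  lookup-rewind : ∀ f i → lookup (areaVec m c (rewind f)) i ≡ lookup (areaVec m c f) i ℤ.+ + (turns * c)
  lookup-rewind f i = begin
    lookup (areaVec m c (rewind f)) i
      ≡⟨ lookup-areaVec m c (rewind f) i ⟩
    line m c i ℤ.- rewind f (lookup (labelSeq (rewind f)) i)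
      ≡⟨ cong (λ w → line m c i ℤ.- rewind f (lookup w i)) (rewind-labelSeq f) ⟩
    line m c i ℤ.- (xs f i ℤ.- X)
      ≡⟨ regroup (line m c i) (xs f i) X ⟩
    (line m c i ℤ.- xs f i) ℤ.+ X
      ≡⟨ cong (ℤ._+ X) (sym (lookup-areaVec m c f i)) ⟩
    lookup (areaVec m c f) i ℤ.+ X ∎
    where
    open ≡-Reasoning
    X : ℤ
    X = + (turns * c)
    regroup : ∀ l x y → l ℤ.- (x ℤ.- y) ≡ (l ℤ.- x) ℤ.+ y
    regroup = solve-∀

  unwind-areaVec : ∀ f → fold (areaVec m c (rewind f)) (cycleG c) (turns * suc n') ≡ areaVec m c f
  unwind-areaVec f = lookup-ext λ i → begin
    lookup (fold g′ (cycleG c) (turns * suc n')) i  ≡⟨ Areas.lookup-fold g′ _ i ⟩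
    Areas.track g′ (toℕ i + turns * suc n')         ≡⟨ cong (Areas.track g′) (ℕₚ.+-comm (toℕ i) _) ⟩
    Areas.track g′ (turns * suc n' + toℕ i)         ≡⟨ decay turns (toℕ i) ⟩
    Areas.track g′ (toℕ i) ℤ.- X                    ≡⟨ cong (ℤ._- X) (sym (Areas.lookup-track g′ i)) ⟩
    lookup g′ i ℤ.- X                               ≡⟨ cong (ℤ._- X) (lookup-rewind f i) ⟩
    (lookup g i ℤ.+ X) ℤ.- X                        ≡⟨ cancel (lookup g i) X ⟩
    lookup g i                                      ∎
    where
    open ≡-Reasoning
    X : ℤ
    X = + (turns * c)
    g g′ : Vec ℤ (suc n')
    g = areaVec m c f
    g′ = areaVec m c (rewind f)
    open Periodic c n' (Areas.track g′) (Areas.track-period g′) using (decay)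
    cancel : ∀ x y → (x ℤ.+ y) ℤ.- y ≡ x
    cancel = solve-∀

  unwind-labelSeq : ∀ f → fold (labelSeq (rewind f)) cycleW (turns * suc n') ≡ labelSeq f
  unwind-labelSeq f = begin
    fold (labelSeq (rewind f)) cycleW L       ≡⟨ cong (λ w → fold w cycleW L) (rewind-labelSeq f) ⟩
    fold (labelSeq f) cycleW L                ≡⟨ Labels.full-turns turns (labelSeq f) ⟩
    map (λ a → fold a id turns) (labelSeq f)  ≡⟨ map-cong (fold-id turns) (labelSeq f) ⟩
    map id (labelSeq f)                       ≡⟨ map-id (labelSeq f) ⟩
    labelSeq f                                ∎
    where
    open ≡-Reasoning
    L : ℕ
    L = turns * suc n'
    fold-id : ∀ q (a : Fin (suc n')) → fold a id q ≡ a
    fold-id zero a = refl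
    fold-id (suc q) a = fold-id q a

  fold-rewind : ∀ f t → fold (areaVec m c f) (cycleG c) t ≡
                         fold (fold (areaVec m c (rewind f)) (cycleG c) t) (cycleG c) (turns * suc n')
  fold-rewind f t = begin
    fold (areaVec m c f) (cycleG c) t         ≡⟨ cong (λ g → fold g (cycleG c) t) (sym (unwind-areaVec f)) ⟩
    fold (fold g′ (cycleG c) L) (cycleG c) t  ≡⟨ sym (fold-+ g′ (cycleG c) t) ⟩
    fold g′ (cycleG c) (t + L)                ≡⟨ cong (fold g′ (cycleG c)) (ℕₚ.+-comm t L) ⟩
    fold g′ (cycleG c) (L + t)                ≡⟨ fold-+ g′ (cycleG c) L ⟩
    fold (fold g′ (cycleG c) t) (cycleG c) L  ∎
    where
    open ≡-Reasoning
    g′ : Vec ℤ (suc n')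
    g′ = areaVec m c (rewind f)
    L : ℕ
    L = turns * suc n'

  rewind-cyclable : ∀ {f} → Cyclable f → Cyclable (rewind f)
  rewind-cyclable {f} cyc = subst (CyclableAt (rewind f)) (sym (rewind-labelSeq f))
    (subst₂ (λ x y → (x , _) ≺ (y , _)) (reorder (f (last w)) (+ m) X) (reorder′ (f (head w)) K X)
            (≺-+ (ℤ.- X) cyc))
    where
    w : Vec (Fin (suc n')) (suc n')
    w = labelSeq f
    X : ℤ
    X = + (turns * c)
    reorder : ∀ x y z → (x ℤ.- y) ℤ.- z ≡ (x ℤ.- z) ℤ.- y
    reorder = solve-∀
    reorder′ : ∀ x y z → (x ℤ.+ y) ℤ.- z ≡ (x ℤ.- z) ℤ.+ y
    reorder′ = solve-∀

  rewind-statF : ∀ {f} → Cyclable f → statF (rewind f) ≡ statF f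
  rewind-statF {f} cyc = begin
    statF (rewind f)
      ≡⟨ sym (statF-fold cyc′ L) ⟩
    statF (fold (rewind f) cycleF L)
      ≡⟨ cong₂ stat (fold-areaVec cyc′ L) (fold-labelSeq cyc′ L) ⟩
    stat (fold (areaVec m c (rewind f)) (cycleG c) L) (fold (labelSeq (rewind f)) cycleW L)
      ≡⟨ cong₂ stat (unwind-areaVec f) (unwind-labelSeq f) ⟩
    statF f ∎
    where
    open ≡-Reasoning
    cyc′ : Cyclable (rewind f)
    cyc′ = rewind-cyclable cyc
    L : ℕ
    L = turns * suc n'

  rewind-positive : ∀ {f} → (∀ a → f a ℤ.< K) → ∀ i → + 0 ℤ.< lookup (areaVec m c (rewind f)) i
  rewind-positive {f} f<K i =
    subst (+ 0 ℤ.<_) (sym (trans (lookup-rewind f i) (cong (ℤ._+ X) (lookup-areaVec m c f i))))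
      (ℤₚ.<-≤-trans (<-by-gap (gap₁ K (xs f i)) (f<K _)) (≤-by-gap (gap₂ (line m c i) K (xs f i) X) K≤line+X))
    where
    X : ℤ
    X = + (turns * c)
    gap₁ : ∀ k x → k ℤ.- x ≡ (k ℤ.- x) ℤ.- + 0
    gap₁ = solve-∀
    gap₂ : ∀ l k x y → (l ℤ.+ y) ℤ.- k ≡ ((l ℤ.- x) ℤ.+ y) ℤ.- (k ℤ.- x)
    gap₂ = solve-∀
    K≤line+X : K ℤ.≤ line m c i ℤ.+ X
    K≤line+X = ℤ.+≤+ (subst (m * n' + c ≤_) (ℕₚ.+-comm (turns * c) _)
                              (ℕₚ.+-mono-≤ (ℕₚ.m≤m*n turns c) (ℕₚ.m≤n+m c (m * toℕ i))))

  module _ {k} (k≤n' : k ≤ n') where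

    open Window c n' k k≤n'

    private
      catch-up : ∀ {g₁ g₂} t {b} → Skeletal (Areas.track g₁) → Skeletal (Areas.track g₂) →
                 fold g₁ (cycleG c) t ≡ fold g₂ (cycleG c) (t + b) → b ≡ 0
      catch-up {g₁} {g₂} t {b} sk₁ sk₂ eq =
        skeletal-unique (Areas.track g₂) (Areas.track-period g₂) sk₂
          (Skeletal-≗ (λ i → trans (cong (λ g → Areas.track g i) g₁≡) (Areas.track-fold g₂ b i)) sk₁)
        where
        g₁≡ : g₁ ≡ fold g₂ (cycleG c) b
        g₁≡ = fold-injective cycleG-injective t (trans eq (fold-+ g₂ (cycleG c) t))

    orbit-unique : ∀ {g₁ g₂ t₁ t₂} → Skeletal (Areas.track g₁) → Skeletal (Areas.track g₂) →
                   fold g₁ (cycleG c) t₁ ≡ fold g₂ (cycleG c) t₂ → t₁ ≡ t₂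
    orbit-unique {t₁ = t₁} {t₂} sk₁ sk₂ eq with ℕₚ.≤-total t₁ t₂
    ... | inj₁ t₁≤t₂ with b , refl ← ℕₚ.m≤n⇒∃[o]m+o≡n t₁≤t₂ =
      sym (trans (cong (λ x → t₁ + x) (catch-up t₁ sk₁ sk₂ eq)) (ℕₚ.+-identityʳ t₁))
    ... | inj₂ t₂≤t₁ with b , refl ← ℕₚ.m≤n⇒∃[o]m+o≡n t₂≤t₁ =
      trans (cong (λ x → t₂ + x) (catch-up t₂ sk₂ sk₁ (sym eq))) (ℕₚ.+-identityʳ t₂)

    skeletal-track : ∀ {f} → IsSkeletal m c k f → Skeletal (Areas.track (areaVec m c f))
    skeletal-track {f} = Bridge.IsSkeletal⇒Skeletal m c n' k k≤n' {f} {Areas.track (areaVec m c f)}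
                           (sym ∘ Areas.lookup-track (areaVec m c f))

  module _ {k₂} (k₂≤n' : k₂ ≤ n') where

    time : (Fin (suc n') → ℤ) → ℕ
    time f = Window.first c n' k₂ k₂≤n' (Areas.track (areaVec m c (rewind f))) (Areas.track-period _)

    advance : (Fin (suc n') → ℤ) → Fin (suc n') → ℤ
    advance f = fold (rewind f) cycleF (time f)

    transport : Vec ℤ (suc n') → Vec ℤ (suc n')
    transport v = tabulate (advance (lookup v))

    private
      lookup-transport : ∀ v → lookup (transport v) ≗ advance (lookup v)
      lookup-transport v = lookup∘tabulate (advance (lookup v))

    transport-statF : ∀ {v} → Cyclable (lookup v) → statF (lookup (transport v)) ≡ statF (lookup v)
    transport-statF {v} cyc = begin
      statF (lookup (transport v))
        ≡⟨ cong₂ stat (areaVec-≗ m c (lookup-transport v)) (labelSeq-≗ (lookup-transport v)) ⟩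
      statF (advance (lookup v))
        ≡⟨ statF-fold (rewind-cyclable cyc) (time (lookup v)) ⟩
      statF (rewind (lookup v))
        ≡⟨ rewind-statF cyc ⟩
      statF (lookup v) ∎
      where open ≡-Reasoning

    module _ {k₁} (k₁≤n' : k₁ ≤ n') where

      private
        module Source = Bridge m c n' k₁ k₁≤n'
        module Target = Bridge m c n' k₂ k₂≤n'

      transport-skeletal : ∀ {v} → IsSkeletal m c k₁ (lookup v) → IsSkeletal m c k₂ (lookup (transport v))
      transport-skeletal {v} sk =
        Target.Skeletal⇒IsSkeletal {lookup (transport v)} {λ i → s (i + time f)} on-orbit
          (Window.first-skeletal c n' k₂ k₂≤n' s (Areas.track-period _) initially-positive)
        where
        f : Fin (suc n') → ℤ
        f = lookup v
        s : ℕ → ℤ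
        s = Areas.track (areaVec m c (rewind f))
        initially-positive : ∀ {p} → p < suc n' → + 0 ℤ.< s p
        initially-positive p<N =
          subst (+ 0 ℤ.<_) (trans (Areas.lookup-track _ (fromℕ< p<N)) (cong s (Finₚ.toℕ-fromℕ< p<N)))
            (rewind-positive (proj₂ ∘ Source.skeletal-bounds {f} sk) (fromℕ< p<N))
        on-orbit : ∀ i → s (toℕ i + time f) ≡ lookup (areaVec m c (lookup (transport v))) i
        on-orbit i = begin
          s (toℕ i + time f)
            ≡⟨ sym (Areas.lookup-fold _ (time f) i) ⟩
          lookup (fold (areaVec m c (rewind f)) (cycleG c) (time f)) i
            ≡⟨ cong (λ g → lookup g i) (sym (fold-areaVec cyc (time f))) ⟩
          lookup (areaVec m c (advance f)) i
            ≡⟨ cong (λ g → lookup g i) (sym (areaVec-≗ m c (lookup-transport v))) ⟩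
          lookup (areaVec m c (lookup (transport v))) i ∎
          where
          open ≡-Reasoning
          cyc : Cyclable (rewind f)
          cyc = rewind-cyclable (Source.skeletal-cyclable {f} sk)

      module _ {v₁ v₂} (sk₁ : IsSkeletal m c k₁ (lookup v₁)) (sk₂ : IsSkeletal m c k₁ (lookup v₂))
               (eq : transport v₁ ≡ transport v₂) where

        private
          f₁ f₂ : Fin (suc n') → ℤ
          f₁ = lookup v₁
          f₂ = lookup v₂

          t₁ t₂ : ℕ
          t₁ = time f₁
          t₂ = time f₂

          cyc₁ : Cyclable (rewind f₁)
          cyc₁ = rewind-cyclable (Source.skeletal-cyclable {f₁} sk₁)

          cyc₂ : Cyclable (rewind f₂)
          cyc₂ = rewind-cyclable (Source.skeletal-cyclable {f₂} sk₂)

          meet : advance f₁ ≗ advance f₂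
          meet a = trans (sym (lookup-transport v₁ a))
                         (trans (cong (λ v → lookup v a) eq) (lookup-transport v₂ a))

        transport-labels-meet : fold (labelSeq f₁) cycleW t₁ ≡ fold (labelSeq f₂) cycleW t₂
        transport-labels-meet = begin
          fold (labelSeq f₁) cycleW t₁           ≡⟨ cong (λ w → fold w cycleW t₁) (sym (rewind-labelSeq f₁)) ⟩
          fold (labelSeq (rewind f₁)) cycleW t₁  ≡⟨ sym (fold-labelSeq cyc₁ t₁) ⟩
          labelSeq (advance f₁)                  ≡⟨ labelSeq-≗ meet ⟩
          labelSeq (advance f₂)                  ≡⟨ fold-labelSeq cyc₂ t₂ ⟩
          fold (labelSeq (rewind f₂)) cycleW t₂  ≡⟨ cong (λ w → fold w cycleW t₂) (rewind-labelSeq f₂) ⟩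
          fold (labelSeq f₂) cycleW t₂           ∎
          where open ≡-Reasoning

        transport-areas-meet : fold (areaVec m c f₁) (cycleG c) t₁ ≡ fold (areaVec m c f₂) (cycleG c) t₂
        transport-areas-meet = begin
          fold (areaVec m c f₁) (cycleG c) t₁
            ≡⟨ fold-rewind f₁ t₁ ⟩
          fold (fold (areaVec m c (rewind f₁)) (cycleG c) t₁) (cycleG c) (turns * suc n')
            ≡⟨ cong (λ g → fold g (cycleG c) (turns * suc n')) rewound-meet ⟩
          fold (fold (areaVec m c (rewind f₂)) (cycleG c) t₂) (cycleG c) (turns * suc n')
            ≡⟨ sym (fold-rewind f₂ t₂) ⟩
          fold (areaVec m c f₂) (cycleG c) t₂ ∎
          where
          open ≡-Reasoning
          rewound-meet : fold (areaVec m c (rewind f₁)) (cycleG c) t₁ ≡ fold (areaVec m c (rewind f₂)) (cycleG c) t₂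
          rewound-meet = trans (sym (fold-areaVec cyc₁ t₁)) (trans (areaVec-≗ m c meet) (fold-areaVec cyc₂ t₂))

        transport-injective : v₁ ≡ v₂
        transport-injective = lookup-ext (areaVec-injective m c labels≡ areas≡)
          where
          t₁≡t₂ : t₁ ≡ t₂
          t₁≡t₂ = orbit-unique k₁≤n' (skeletal-track k₁≤n' {f₁} sk₁) (skeletal-track k₁≤n' {f₂} sk₂)
                               transport-areas-meet
          areas≡ : areaVec m c f₁ ≡ areaVec m c f₂
          areas≡ = fold-injective cycleG-injective t₁
                     (trans transport-areas-meet (cong (fold (areaVec m c f₂) (cycleG c)) (sym t₁≡t₂)))
          labels≡ : labelSeq f₁ ≡ labelSeq f₂
          labels≡ = fold-injective cycleW-injective t₁
                      (trans transport-labels-meet (cong (fold (labelSeq f₂) cycleW) (sym t₁≡t₂)))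

  skeletal-∈-box : ∀ {k} → k ≤ n' → ∀ {v} → IsSkeletal m c k (lookup v) → v ∈ₗ box (suc n') m c
  skeletal-∈-box k≤n' {v} sk = ∈-vecsOver v λ a →
    ∈-naturals (proj₁ (bounds a)) (ℤₚ.<-≤-trans (proj₂ (bounds a)) (ℤ.+≤+ K≤bound))
    where
    bounds : ∀ a → + 0 ℤ.≤ lookup v a × lookup v a ℤ.< K
    bounds = Bridge.skeletal-bounds m c n' _ k≤n' {lookup v} sk
    K≤bound : m * n' + c ≤ m * suc n' + c
    K≤bound = ℕₚ.+-monoˡ-≤ c (ℕₚ.*-monoʳ-≤ m (ℕₚ.n≤1+n n'))

  coeffP-≤ : ∀ {k₁ k₂} → k₁ ≤ n' → k₂ ≤ n' → ∀ d →
             coeffP (suc n') m c stat k₁ d ≤ coeffP (suc n') m c stat k₂ d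
  coeffP-≤ {k₁} {k₂} k₁≤n' k₂≤n' d =
    length-≤ (Uniqueₚ.filter⁺ (counts? k₁) (box-unique (suc n') m c)) (transport k₂≤n') moves separates
    where
    counts? : ∀ k → Decidable (λ v → IsSkeletal m c k (lookup v) × statF (lookup v) ≡ d)
    counts? k v = skeletal? m c k (lookup v) ×-dec (statF (lookup v) ℕ.≟ d)

    counted : ℕ → List (Vec ℤ (suc n'))
    counted k = filter (counts? k) (box (suc n') m c)

    counted⁻ : ∀ {k v} → v ∈ₗ counted k → IsSkeletal m c k (lookup v) × statF (lookup v) ≡ d
    counted⁻ {k} v∈ = proj₂ (∈-filter⁻ (counts? k) {xs = box (suc n') m c} v∈)

    moves : ∀ {v} → v ∈ₗ counted k₁ → transport k₂≤n' v ∈ₗ counted k₂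
    moves {v} v∈ with sk , st ← counted⁻ {k₁} v∈ =
      ∈-filter⁺ (counts? k₂) (skeletal-∈-box k₂≤n' {transport k₂≤n' v} sk′)
        (sk′ , trans (transport-statF k₂≤n' {v} (Bridge.skeletal-cyclable m c n' k₁ k₁≤n' {lookup v} sk)) st)
      where
      sk′ : IsSkeletal m c k₂ (lookup (transport k₂≤n' v))
      sk′ = transport-skeletal k₂≤n' k₁≤n' {v} sk

    separates : ∀ {v₁ v₂} → v₁ ∈ₗ counted k₁ → v₂ ∈ₗ counted k₁ →
                transport k₂≤n' v₁ ≡ transport k₂≤n' v₂ → v₁ ≡ v₂
    separates {v₁} {v₂} v₁∈ v₂∈ =
      transport-injective k₂≤n' k₁≤n' {v₁} {v₂}
        (proj₁ (counted⁻ {k₁} v₁∈)) (proj₁ (counted⁻ {k₁} v₂∈))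

-- The proof does not need m > 0.
theorem5p2 : (n m c : ℕ) → .{{NonZero n}} → .{{NonZero m}} → .{{NonZero c}} →
    (stat : Vec ℤ n → Vec (Fin n) n → ℕ) →
    (∀ g w → IsAV m g → IsRearr w → IsAV m (cycleG c g) → IsRearr (cycleW w) →
      stat (cycleG c g) (cycleW w) ≡ stat g w) →
    ∀ k k′ → k < n → k′ < n → ∀ d → coeffP n m c stat k d ≡ coeffP n m c stat k′ d
theorem5p2 zero m c stat stat-cycle k k′ () k′<n d
theorem5p2 (suc n') m c stat stat-cycle k k′ k<n k′<n d =
  ℕₚ.≤-antisym (coeffP-≤ k≤n' k′≤n' d) (coeffP-≤ k′≤n' k≤n' d)
  where
  open Transport n' m c stat stat-cycle
  k≤n' : k ≤ n'
  k≤n' = ℕₚ.≤-pred k<n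
  k′≤n' : k′ ≤ n'
  k′≤n' = ℕₚ.≤-pred k′<n
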